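{- There exist deterministic integral NDAs $\mathcal{A}$ and $\mathcal{B}$ over the same alphabet such that no integral NMDA $\mathcal{C}$ satisfies $\mathcal{C}(w)=\max(\mathcal{A}(w),\mathcal{B}(w))$ for all words $w$, and no integral NMDA $\mathcal{C}$ satisfies $\mathcal{C}(w)=\mathcal{A}(w)+\mathcal{B}(w)$ for all words $w$; this holds both when "all words" means all finite words and when it means all infinite words.
   Context: An alphabet $\Sigma$ is a finite nonempty set; $\Sigma^+$ denotes the nonempty finite words and $\Sigma^\omega$ the infinite words; "finite words" range over $\Sigma^+$. An NMDA is a tuple $\mathcal{A}=\langle \Sigma,Q,\iota,\delta,\gamma,\rho\rangle$ with finite state set $Q$, initial states $\iota\subseteq Q$, transition relation $\delta\subseteq Q\times\Sigma\times Q$, weight function $\gamma:\delta\to\mathbb{Q}$ and discount-factor function $\rho:\delta\to\mathbb{Q}\cap(1,\infty)$; NMDAs are assumed complete (every state has at least one outgoing transition on every letter). A run on a word $w=\sigma_0\sigma_1\cdots$ is $p_0,\sigma_0,p_1,\ldots$ with $p_0\in\iota$ and $t_i=(p_i,\sigma_i,p_{i+1})\in\delta$; its value is $\sum_i\gamma(t_i)\prod_{j<i}\frac{1}{\rho(t_j)}$, and $\mathcal{A}(w)$ is the infimum of the values of runs on $w$. $\mathcal{A}$ is deterministic if $|\iota|=1$ and each $(q,\sigma)$ has at most one successor; integral if all discount factors are integers. An NDA is an NMDA in which all transitions carry the same discount factor; an integral NDA is one whose single discount factor is an integer. -}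

module Defs where

open import Data.Nat as ℕ using (ℕ; zero; suc)
open import Data.Fin using (Fin)
open import Data.Bool using (Bool; true)
open import Data.Integer using (ℤ; +_)
open import Data.List using (List; []; _∷_)
open import Data.Rational
  using (ℚ; 0ℚ; 1ℚ; _+_; _*_; _≤_; _<_; _⊔_; 1/_; _/_; positive)
open import Data.Rational.Properties using (<-trans; pos⇒nonZero)
open import Data.Product using (Σ; ∃; _×_; _,_)
open import Relation.Binary.PropositionalEquality using (_≡_)

0<1 : 0ℚ < 1ℚ
0<1 = Data.Rational.*<* (Data.Integer.+<+ (ℕ.s≤s ℕ.z≤n))

inv>1 : (r : ℚ) → 1ℚ < r → ℚ
inv>1 r 1<r = (1/ r) {{pos⇒nonZero r {{positive (<-trans 0<1 1<r)}}}}

-- States: Fin n.  ι : initial-state indicator.  δ : transition indicator.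
-- γ, ρ are given as total functions on Q × Σ × Q; only their values on
-- transitions (δ p σ q ≡ true) are ever used.  Discount factors are
-- required to be > 1 (everywhere, which loses no generality).

record NMDA (k : ℕ) : Set where
  field
    n        : ℕ
    ι        : Fin n → Bool
    δ        : Fin n → Fin k → Fin n → Bool
    γ        : Fin n → Fin k → Fin n → ℚ
    ρ        : Fin n → Fin k → Fin n → ℚ
    ρ>1      : ∀ p σ q → 1ℚ < ρ p σ q
    complete : ∀ p σ → ∃ λ q → δ p σ q ≡ true

open NMDA public

invρ : ∀ {k} (A : NMDA k) → Fin (n A) → Fin k → Fin (n A) → ℚ
invρ A p σ q = inv>1 (ρ A p σ q) (ρ>1 A p σ q)

Deterministic : ∀ {k} → NMDA k → Set
Deterministic A =
  (∃ λ q₀ → (∀ q → ι A q ≡ true → q ≡ q₀) × ι A q₀ ≡ true) ×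
  (∀ p σ q q' → δ A p σ q ≡ true → δ A p σ q' ≡ true → q ≡ q')

Integral : ∀ {k} → NMDA k → Set
Integral A = ∀ p σ q → δ A p σ q ≡ true → ∃ λ (z : ℤ) → ρ A p σ q ≡ z / 1

IntegralNDA : ∀ {k} → NMDA k → Set
IntegralNDA A = ∃ λ (λ' : ℕ) →
  ∀ p σ q → δ A p σ q ≡ true → ρ A p σ q ≡ (+ λ') / 1

-- The value of a run
-- t₀ t₁ … is  γ(t₀) + (1/ρ(t₀)) · value(t₁ …), i.e.
-- Σ_i γ(t_i) Π_{j<i} 1/ρ(t_j).

data RunFrom {k} (A : NMDA k) : Fin (n A) → List (Fin k) → ℚ → Set where
  end  : ∀ {q} → RunFrom A q [] 0ℚ
  step : ∀ {p σ q w v} → δ A p σ q ≡ true → RunFrom A q w v →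
         RunFrom A p (σ ∷ w) (γ A p σ q + invρ A p σ q * v)

RunVal : ∀ {k} → NMDA k → List (Fin k) → ℚ → Set
RunVal A w v = ∃ λ q → ι A q ≡ true × RunFrom A q w v

-- A(w) = v  (the infimum over the finitely many runs is their minimum;
-- if there is no run, A(w) = +∞ equals no rational)
ValueIs : ∀ {k} → NMDA k → List (Fin k) → ℚ → Set
ValueIs A w v = RunVal A w v × (∀ v' → RunVal A w v' → v ≤ v')

NonEmpty : ∀ {k} → List (Fin k) → Set
NonEmpty w = ∃ λ σ → ∃ λ w' → w ≡ σ ∷ w'

IsRun : ∀ {k} (A : NMDA k) → (ℕ → Fin k) → (ℕ → Fin (n A)) → Set
IsRun A w r = ι A (r 0) ≡ true × (∀ i → δ A (r i) (w i) (r (suc i)) ≡ true)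

invDisc : ∀ {k} (A : NMDA k) → (ℕ → Fin k) → (ℕ → Fin (n A)) → ℕ → ℚ
invDisc A w r zero    = 1ℚ
invDisc A w r (suc i) = invDisc A w r i * invρ A (r i) (w i) (r (suc i))

-- partial sums  Σ_{i<N} γ(t_i) Π_{j<i} 1/ρ(t_j); the value of the run is
-- their limit (which always exists).
partial : ∀ {k} (A : NMDA k) → (ℕ → Fin k) → (ℕ → Fin (n A)) → ℕ → ℚ
partial A w r zero    = 0ℚ
partial A w r (suc i) =
  partial A w r i + γ A (r i) (w i) (r (suc i)) * invDisc A w r i

-- For convergent rational sequences s, t:  LimLe s t  ⇔  lim s ≤ lim t.
LimLe : (ℕ → ℚ) → (ℕ → ℚ) → Set
LimLe s t = ∀ ε → 0ℚ < ε →
  ∃ λ N → ∀ m → N ℕ.≤ m → s m ≤ t m + ε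

-- C(w) = lim m   for a convergent rational sequence m:
--   every run of C has value ≥ lim m, and
--   for every ε > 0 some run has value ≤ lim m + ε.
-- (If C has no run on w, C(w) = +∞ and this fails.)
InfValueIs : ∀ {k} → NMDA k → (ℕ → Fin k) → (ℕ → ℚ) → Set
InfValueIs C w m =
  (∀ r → IsRun C w r → LimLe m (partial C w r)) ×
  (∀ ε → 0ℚ < ε → ∃ λ r → IsRun C w r × LimLe (partial C w r) (λ i → m i + ε))

ComputesMaxFin : ∀ {k} → NMDA k → NMDA k → NMDA k → Set
ComputesMaxFin C A B = ∀ w → NonEmpty w → ∀ va vb →
  ValueIs A w va → ValueIs B w vb → ValueIs C w (va ⊔ vb)

ComputesSumFin : ∀ {k} → NMDA k → NMDA k → NMDA k → Set
ComputesSumFin C A B = ∀ w → NonEmpty w → ∀ va vb →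
  ValueIs A w va → ValueIs B w vb → ValueIs C w (va + vb)

-- C computes max / sum of A and B on all infinite words.  Used only for
-- deterministic complete A, B, whose value on w is the value (limit of
-- partial sums) of their unique run on w.

ComputesMaxInf : ∀ {k} → NMDA k → NMDA k → NMDA k → Set
ComputesMaxInf C A B = ∀ w rA rB → IsRun A w rA → IsRun B w rB →
  InfValueIs C w (λ i → partial A w rA i ⊔ partial B w rB i)

ComputesSumInf : ∀ {k} → NMDA k → NMDA k → NMDA k → Set
ComputesSumInf C A B = ∀ w rA rB → IsRun A w rA → IsRun B w rB →
  InfValueIs C w (λ i → partial A w rA i + partial B w rB i)

{-# OPTIONS --safe #-}
-- Over the letters a, c, b, h let 𝒜 be the single-state automaton with discount 2 and
-- weights a ↦ 3, c ↦ 0, b ↦ 12, h ↦ 0, and ℬ the one with discount 3 and weights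
-- a, c ↦ 4, b, h ↦ 0.  Then max(𝒜, ℬ)(aⁿ) = ℬ(aⁿ) = 6 - 6/3ⁿ and (𝒜 + ℬ)(cⁿ) = 6 - 6/3ⁿ,
-- while appending b raises either value by at least 6/2ⁿ; likewise for aⁿh^ω and cⁿh^ω
-- against aⁿbh^ω and cⁿbh^ω.
--
-- Let C be integral, with weights of common denominator d + 1 and absolute value at most G.
-- The value of a run whose discount factors multiply to P is an integer over (d + 1) P, so
-- a value 6 - 6/3ⁿ forces 3ⁿ ≤ 6 (d + 1) P.  One more letter changes the value by at most
-- G/P, and against the gap 6/2ⁿ this gives 6 P ≤ G 2ⁿ; as 3ⁿ outgrows 2ⁿ, this fails for
-- large n.  On infinite words optimal runs need not exist, so we take runs that are optimal
-- up to a tiny e.  By pigeonhole two of them, on words of lengths ℓ₁ < ℓ₂, pass through the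
-- same state after ℓ₁ and ℓ₂ letters; exchanging their tails shows that their rescaled
-- residual values are integers less than 1 apart, hence equal, and the same denominator
-- argument then forces P₂ = 3^(ℓ₂ - ℓ₁) P₁, which contradicts P₂ = O(2^ℓ₂).

module Submission where

open import Defs
open import Data.Nat as ℕ using (ℕ; zero; suc; _^_)
open import Data.Nat.Divisibility using (_∣_; divides; ∣⇒≤)
import Data.Nat.Properties as ℕP
open import Data.Nat.Tactic.RingSolver using () renaming (solve-∀ to ℕ-solve-∀)
open import Data.Integer as ℤ using (ℤ; +_; -[1+_])
import Data.Integer.Properties as ℤP
open import Data.Rational as ℚ using (ℚ; 0ℚ; 1ℚ; _+_; _*_; _-_; -_; _≤_; _<_; _/_; mkℚ; _⊔_)
import Data.Rational.Properties as ℚP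
open import Data.Rational.Solver using (module +-*-Solver)
open +-*-Solver using (solve; _:=_; _:+_; _:*_; _:-_; :-_; con)
open import Data.Rational.Unnormalised as ℚᵘ using (mkℚᵘ; _≃_; *≡*)
import Data.Rational.Unnormalised.Properties as ℚᵘP
open import Data.Fin using (Fin; zero; suc; toℕ)
import Data.Fin.Properties as Finₚ
open import Data.Bool using (true)
open import Data.List using (List; []; _∷_; _++_; replicate)
open import Data.List.Properties using (++-identityʳ)
open import Data.Product using (Σ; ∃; _×_; _,_; proj₁; proj₂)
open import Data.Empty using (⊥; ⊥-elim)
open import Data.Sum using (inj₁; inj₂)
open import Relation.Binary.PropositionalEquality
open import Relation.Nullary using (¬_; yes; no)


fromℤ : ℤ → ℚ
fromℤ z = z / 1

fromℕ : ℕ → ℚ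
fromℕ m = fromℤ (+ m)

private
  toℚᵘ-fromℤ : ∀ z → ℚ.toℚᵘ (fromℤ z) ≃ mkℚᵘ z 0
  toℚᵘ-fromℤ z = ℚP.toℚᵘ-fromℚᵘ (mkℚᵘ z 0)

fromℤ-+ : ∀ x y → fromℤ (x ℤ.+ y) ≡ fromℤ x + fromℤ y
fromℤ-+ x y = ℚP.toℚᵘ-injective (begin
  ℚ.toℚᵘ (fromℤ (x ℤ.+ y))                   ≈⟨ toℚᵘ-fromℤ (x ℤ.+ y) ⟩
  mkℚᵘ (x ℤ.+ y) 0                           ≈⟨ *≡* (cong₂ (λ a b → (a ℤ.+ b) ℤ.* + 1)
                                                        (sym (ℤP.*-identityʳ x)) (sym (ℤP.*-identityʳ y))) ⟩
  mkℚᵘ x 0 ℚᵘ.+ mkℚᵘ y 0                     ≈⟨ ℚᵘP.+-cong (toℚᵘ-fromℤ x) (toℚᵘ-fromℤ y) ⟨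
  ℚ.toℚᵘ (fromℤ x) ℚᵘ.+ ℚ.toℚᵘ (fromℤ y)     ≈⟨ ℚP.toℚᵘ-homo-+ (fromℤ x) (fromℤ y) ⟨
  ℚ.toℚᵘ (fromℤ x + fromℤ y)                 ∎)
  where open ℚᵘP.≃-Reasoning

fromℤ-* : ∀ x y → fromℤ (x ℤ.* y) ≡ fromℤ x * fromℤ y
fromℤ-* x y = ℚP.toℚᵘ-injective (begin
  ℚ.toℚᵘ (fromℤ (x ℤ.* y))                   ≈⟨ toℚᵘ-fromℤ (x ℤ.* y) ⟩
  mkℚᵘ x 0 ℚᵘ.* mkℚᵘ y 0                     ≈⟨ ℚᵘP.*-cong (toℚᵘ-fromℤ x) (toℚᵘ-fromℤ y) ⟨
  ℚ.toℚᵘ (fromℤ x) ℚᵘ.* ℚ.toℚᵘ (fromℤ y)     ≈⟨ ℚP.toℚᵘ-homo-* (fromℤ x) (fromℤ y) ⟨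
  ℚ.toℚᵘ (fromℤ x * fromℤ y)                 ∎)
  where open ℚᵘP.≃-Reasoning

fromℤ-neg : ∀ x → fromℤ (ℤ.- x) ≡ - fromℤ x
fromℤ-neg x = ℚP.toℚᵘ-injective (begin
  ℚ.toℚᵘ (fromℤ (ℤ.- x))     ≈⟨ toℚᵘ-fromℤ (ℤ.- x) ⟩
  ℚᵘ.- mkℚᵘ x 0              ≈⟨ ℚᵘP.-‿cong (toℚᵘ-fromℤ x) ⟨
  ℚᵘ.- ℚ.toℚᵘ (fromℤ x)      ≈⟨ ℚP.toℚᵘ-homo‿- (fromℤ x) ⟨
  ℚ.toℚᵘ (- fromℤ x)         ∎)
  where open ℚᵘP.≃-Reasoning

fromℤ-minus : ∀ x y → fromℤ (x ℤ.- y) ≡ fromℤ x - fromℤ y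
fromℤ-minus x y = trans (fromℤ-+ x (ℤ.- y)) (cong (λ u → fromℤ x + u) (fromℤ-neg y))

fromℤ-mono-≤ : ∀ {x y} → x ℤ.≤ y → fromℤ x ≤ fromℤ y
fromℤ-mono-≤ {x} {y} x≤y = ℚP.toℚᵘ-cancel-≤
  (ℚᵘP.≤-respˡ-≃ (ℚᵘP.≃-sym (toℚᵘ-fromℤ x)) (ℚᵘP.≤-respʳ-≃ (ℚᵘP.≃-sym (toℚᵘ-fromℤ y))
    (ℚᵘ.*≤* (ℤP.*-monoʳ-≤-nonNeg (+ 1) x≤y))))

fromℤ-cancel-≤ : ∀ {x y} → fromℤ x ≤ fromℤ y → x ℤ.≤ y
fromℤ-cancel-≤ {x} {y} le with ℚᵘP.≤-respˡ-≃ (toℚᵘ-fromℤ x) (ℚᵘP.≤-respʳ-≃ (toℚᵘ-fromℤ y) (ℚP.toℚᵘ-mono-≤ le))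
... | ℚᵘ.*≤* x*1≤y*1 = subst₂ ℤ._≤_ (ℤP.*-identityʳ x) (ℤP.*-identityʳ y) x*1≤y*1

fromℤ-cancel-< : ∀ {x y} → fromℤ x < fromℤ y → x ℤ.< y
fromℤ-cancel-< {x} {y} x<y = ℤP.≰⇒> (λ y≤x → ℚP.<-irrefl refl (ℚP.<-≤-trans x<y (fromℤ-mono-≤ y≤x)))

fromℤ-injective : ∀ {x y} → fromℤ x ≡ fromℤ y → x ≡ y
fromℤ-injective eq = ℤP.≤-antisym (fromℤ-cancel-≤ (ℚP.≤-reflexive eq)) (fromℤ-cancel-≤ (ℚP.≤-reflexive (sym eq)))

fromℕ-+ : ∀ a b → fromℕ (a ℕ.+ b) ≡ fromℕ a + fromℕ b
fromℕ-+ a b = fromℤ-+ (+ a) (+ b)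

fromℕ-* : ∀ a b → fromℕ (a ℕ.* b) ≡ fromℕ a * fromℕ b
fromℕ-* a b = trans (cong fromℤ (ℤP.pos-* a b)) (fromℤ-* (+ a) (+ b))

fromℕ-mono-≤ : ∀ {a b} → a ℕ.≤ b → fromℕ a ≤ fromℕ b
fromℕ-mono-≤ a≤b = fromℤ-mono-≤ (ℤ.+≤+ a≤b)

fromℕ-cancel-≤ : ∀ {a b} → fromℕ a ≤ fromℕ b → a ℕ.≤ b
fromℕ-cancel-≤ {a} {b} le with fromℤ-cancel-≤ {+ a} {+ b} le
... | ℤ.+≤+ a≤b = a≤b

fromℕ-mono-< : ∀ {a b} → a ℕ.< b → fromℕ a < fromℕ b
fromℕ-mono-< {a} {b} a<b = ℚP.≰⇒> (λ b≤a → ℕP.<⇒≱ a<b (fromℕ-cancel-≤ {b} {a} b≤a))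

fromℕ-nonNeg : ∀ a → 0ℚ ≤ fromℕ a
fromℕ-nonNeg a = fromℕ-mono-≤ {0} {a} ℕ.z≤n

fromℕ-pos : ∀ {a} → 1 ℕ.≤ a → 0ℚ < fromℕ a
fromℕ-pos {a} 1≤a = ℚP.<-≤-trans 0<1 (fromℕ-mono-≤ {1} {a} 1≤a)

*-nonNeg : ∀ {x y} → 0ℚ ≤ x → 0ℚ ≤ y → 0ℚ ≤ x * y
*-nonNeg {x} {y} 0≤x 0≤y = ℚP.nonNegative⁻¹ (x * y) {{ℚP.nonNeg*nonNeg⇒nonNeg x {{ℚ.nonNegative 0≤x}} y {{ℚ.nonNegative 0≤y}}}}

+-cancelʳ-≤ : ∀ c {x y} → x + c ≤ y + c → x ≤ y
+-cancelʳ-≤ c {x} {y} x+c≤y+c = subst₂ _≤_ (undo x c) (undo y c) (ℚP.+-monoˡ-≤ (- c) x+c≤y+c)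
  where
  undo : ∀ z c → z + c - c ≡ z
  undo = solve 2 (λ z c → z :+ c :- c := z) refl

*-cancelʳ-≤-fromℕ : ∀ {a b X} → 1 ℕ.≤ X → a * fromℕ X ≤ b * fromℕ X → a ≤ b
*-cancelʳ-≤-fromℕ {X = X} 1≤X = ℚP.*-cancelʳ-≤-pos (fromℕ X) {{ℚ.positive (fromℕ-pos {X} 1≤X)}}

*-cancelʳ-≡-fromℕ : ∀ {a b X} → 1 ℕ.≤ X → a * fromℕ X ≡ b * fromℕ X → a ≡ b
*-cancelʳ-≡-fromℕ {X = X} 1≤X aX≡bX = ℚP.≤-antisym (*-cancelʳ-≤-fromℕ {X = X} 1≤X (ℚP.≤-reflexive aX≡bX))
                                                   (*-cancelʳ-≤-fromℕ {X = X} 1≤X (ℚP.≤-reflexive (sym aX≡bX)))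

*-mono-≤-+ : ∀ {x y ε} c → 0ℚ ≤ c → x ≤ y + ε → x * c ≤ y * c + ε * c
*-mono-≤-+ {x} {y} {ε} c 0≤c x≤y+ε =
  ℚP.≤-trans (ℚP.*-monoʳ-≤-nonNeg c {{ℚ.nonNegative 0≤c}} x≤y+ε) (ℚP.≤-reflexive (ℚP.*-distribʳ-+ c y ε))

p≤∣p∣ : ∀ p → p ≤ ℚ.∣ p ∣
p≤∣p∣ p@(mkℚ (+ _) _ _)    = ℚP.≤-refl
p≤∣p∣ p@(mkℚ -[1+ _ ] _ _) = ℚP.≤-trans (ℚP.nonPositive⁻¹ p) (ℚP.0≤∣p∣ p)

IsIntegral : ℚ → Set
IsIntegral q = ∃ λ z → q ≡ fromℤ z

fromℤ-integral : ∀ z → IsIntegral (fromℤ z)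
fromℤ-integral z = z , refl

fromℕ-integral : ∀ n → IsIntegral (fromℕ n)
fromℕ-integral n = + n , refl

+-integral : ∀ {p q} → IsIntegral p → IsIntegral q → IsIntegral (p + q)
+-integral (a , refl) (b , refl) = a ℤ.+ b , sym (fromℤ-+ a b)

*-integral : ∀ {p q} → IsIntegral p → IsIntegral q → IsIntegral (p * q)
*-integral (a , refl) (b , refl) = a ℤ.* b , sym (fromℤ-* a b)

integral-≤-+< : ∀ {x y ε} → IsIntegral x → IsIntegral y → x ≤ y + ε → ε < 1ℚ → x ≤ y
integral-≤-+< {ε = ε} (a , refl) (b , refl) a≤b+ε ε<1 with a ℤP.≤? b
... | yes a≤b = fromℤ-mono-≤ a≤b
... | no  a≰b = ⊥-elim (ℚP.<-irrefl refl (ℚP.<-≤-trans a<1+b 1+b≤a))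
  where
  a<1+b : fromℤ a < 1ℚ + fromℤ b
  a<1+b = ℚP.≤-<-trans a≤b+ε (subst (fromℤ b + ε <_) (ℚP.+-comm (fromℤ b) 1ℚ) (ℚP.+-monoʳ-< (fromℤ b) ε<1))
  1+b≤a : 1ℚ + fromℤ b ≤ fromℤ a
  1+b≤a = subst (_≤ fromℤ a) (fromℤ-+ (+ 1) b) (fromℤ-mono-≤ (ℤP.i<j⇒suc[i]≤j (ℤP.≰⇒> a≰b)))

denominator-integral : ∀ q → IsIntegral (q * fromℕ (ℚ.↧ₙ q))
denominator-integral q@(mkℚ n d _) = n , ℚP.toℚᵘ-injective (begin
  ℚ.toℚᵘ (q * fromℕ (suc d))                 ≈⟨ ℚP.toℚᵘ-homo-* q (fromℕ (suc d)) ⟩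
  mkℚᵘ n d ℚᵘ.* ℚ.toℚᵘ (fromℕ (suc d))       ≈⟨ ℚᵘP.*-congˡ {mkℚᵘ n d} (toℚᵘ-fromℤ (+ suc d)) ⟩
  mkℚᵘ n d ℚᵘ.* mkℚᵘ (+ suc d) 0             ≈⟨ *≡* (trans (ℤP.*-identityʳ _)
                                                        (cong (n ℤ.*_) (cong +_ (sym (ℕP.*-identityʳ (suc d)))))) ⟩
  mkℚᵘ n 0                                   ≈⟨ toℚᵘ-fromℤ n ⟨
  ℚ.toℚᵘ (fromℤ n)                           ∎)
  where open ℚᵘP.≃-Reasoning

∣q∣≤∣numerator∣ : ∀ q → ℚ.∣ q ∣ ≤ fromℕ ℤ.∣ ℚ.↥ q ∣
∣q∣≤∣numerator∣ (mkℚ n d _) = ℚP.toℚᵘ-cancel-≤ (ℚᵘP.≤-respʳ-≃ (ℚᵘP.≃-sym (toℚᵘ-fromℤ (+ ℤ.∣ n ∣))) (ℚᵘ.*≤*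
  (subst₂ ℤ._≤_ (sym (ℤP.*-identityʳ (+ ℤ.∣ n ∣))) (ℤP.pos-* ℤ.∣ n ∣ (suc d)) (ℤ.+≤+ (ℕP.m≤m*n ℤ.∣ n ∣ (suc d))))))

infix 4 _∣ℚ_
_∣ℚ_ : ℕ → ℚ → Set
N ∣ℚ x = ∃ λ z → x ≡ fromℤ z * fromℕ N

∣ℚ⇒integral : ∀ {N x} → N ∣ℚ x → IsIntegral x
∣ℚ⇒integral {N} (z , refl) = *-integral (fromℤ-integral z) (fromℕ-integral N)

∣ℚ-+fromℕ⇒integral : ∀ {X x a} → X ∣ℚ x + fromℕ a → IsIntegral x
∣ℚ-+fromℕ⇒integral {X} {x} {a} div = subst IsIntegral (cancel x (fromℕ a))
  (+-integral (∣ℚ⇒integral {X} div) (subst IsIntegral (fromℤ-neg (+ a)) (fromℤ-integral (ℤ.- + a))))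
  where
  cancel : ∀ x a → x + a + - a ≡ x
  cancel = solve 2 (λ x a → x :+ a :+ :- a := x) refl

∣ℚ-* : ∀ {N x} → N ∣ℚ x → ∀ M → M ℕ.* N ∣ℚ x * fromℕ M
∣ℚ-* {N} (z , refl) M = z , (begin
  fromℤ z * fromℕ N * fromℕ M   ≡⟨ ℚP.*-assoc (fromℤ z) (fromℕ N) (fromℕ M) ⟩
  fromℤ z * (fromℕ N * fromℕ M) ≡⟨ cong (fromℤ z *_) (trans (cong fromℕ (ℕP.*-comm M N)) (fromℕ-* N M)) ⟨
  fromℤ z * fromℕ (M ℕ.* N)     ∎)
  where open ≡-Reasoning

∣ℚ-lift : ∀ {X x a} → X ∣ℚ x * fromℕ X + fromℕ a → ∀ M → M ℕ.* X ∣ℚ x * fromℕ (M ℕ.* X) + fromℕ (a ℕ.* M)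
∣ℚ-lift {X} {x} {a} div M = subst (M ℕ.* X ∣ℚ_) eq (∣ℚ-* div M)
  where
  eq : (x * fromℕ X + fromℕ a) * fromℕ M ≡ x * fromℕ (M ℕ.* X) + fromℕ (a ℕ.* M)
  eq = trans (distribute x (fromℕ X) (fromℕ a) (fromℕ M))
             (sym (cong₂ (λ y z → x * y + z) (fromℕ-* M X) (fromℕ-* a M)))
    where
    distribute : ∀ x X a M → (x * X + a) * M ≡ x * (M * X) + a * M
    distribute = solve 4 (λ x X a M → (x :* X :+ a) :* M := x :* (M :* X) :+ a :* M) refl

∣ℚ-minus : ∀ {N x y} → N ∣ℚ x → N ∣ℚ y → N ∣ℚ x - y
∣ℚ-minus {N} (a , refl) (b , refl) = a ℤ.- b , (begin
  fromℤ a * fromℕ N - fromℤ b * fromℕ N  ≡⟨ factor (fromℤ a) (fromℤ b) (fromℕ N) ⟩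
  (fromℤ a - fromℤ b) * fromℕ N          ≡⟨ cong (_* fromℕ N) (fromℤ-minus a b) ⟨
  fromℤ (a ℤ.- b) * fromℕ N              ∎)
  where
  open ≡-Reasoning
  factor : ∀ a b n → a * n - b * n ≡ (a - b) * n
  factor = solve 3 (λ a b n → a :* n :- b :* n := (a :- b) :* n) refl

∣ℚ-fromℕ-minus⇒≡ : ∀ {A B N} → A ℕ.< N → B ℕ.< N → N ∣ℚ fromℕ A - fromℕ B → A ≡ B
∣ℚ-fromℕ-minus⇒≡ {A} {B} {N} A<N B<N (z , eq) = ℤP.+-injective (ℤP.i-j≡0⇒i≡j (+ A) (+ B) (trans A-B≡zN (cong (ℤ._* + N) z≡0)))
  where
  A-B≡zN : + A ℤ.- + B ≡ z ℤ.* + N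
  A-B≡zN = fromℤ-injective {+ A ℤ.- + B} {z ℤ.* + N} (trans (fromℤ-minus (+ A) (+ B)) (trans eq (sym (fromℤ-* z (+ N)))))
  ∣z∣*N<N : ℤ.∣ z ∣ ℕ.* N ℕ.< N
  ∣z∣*N<N = subst (ℕ._< N) (trans (cong ℤ.∣_∣ (trans (sym (ℤP.m-n≡m⊖n A B)) A-B≡zN)) (ℤP.abs-* z (+ N)))
                  (ℕP.≤-<-trans (ℤP.∣m⊝n∣≤m⊔n A B) (ℕP.⊔-lub A<N B<N))
  ∣z∣≡0 : ∀ t → t ℕ.* N ℕ.< N → t ≡ 0
  ∣z∣≡0 zero    _   = refl
  ∣z∣≡0 (suc t) tN<N = ⊥-elim (ℕP.<⇒≱ tN<N (ℕP.m≤m+n N (t ℕ.* N)))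
  z≡0 : z ≡ + 0
  z≡0 = ℤP.∣i∣≡0⇒i≡0 (∣z∣≡0 ℤ.∣ z ∣ ∣z∣*N<N)

-- T = c (1 - 1/X) with the division cleared; a record, so that T, X and c can be inferred.
infix 4 _≡[1-1/_]_
record _≡[1-1/_]_ (T : ℚ) (X : ℕ) (c : ℚ) : Set where
  constructor scaled
  field equation : T * fromℕ X ≡ c * fromℕ X - c

open _≡[1-1/_]_ using (equation)

≡[1-1/]⇒≤ : ∀ {T X c} → 1 ℕ.≤ X → 0ℚ ≤ c → T ≡[1-1/ X ] c → T ≤ c
≡[1-1/]⇒≤ {T} {X} {c} 1≤X 0≤c (scaled T≡) = *-cancelʳ-≤-fromℕ {X = X} 1≤X (begin
  T * fromℕ X          ≡⟨ T≡ ⟩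
  c * fromℕ X - c      ≤⟨ ℚP.+-monoʳ-≤ (c * fromℕ X) (ℚP.neg-antimono-≤ 0≤c) ⟩
  c * fromℕ X - 0ℚ     ≡⟨ ℚP.+-identityʳ (c * fromℕ X) ⟩
  c * fromℕ X          ∎)
  where open ℚP.≤-Reasoning

≡[1-1/]-mono : ∀ {T T' X Y c} → 1 ℕ.≤ X → X ℕ.≤ Y → 0ℚ ≤ c → T ≡[1-1/ X ] c → T' ≡[1-1/ Y ] c → T ≤ T'
≡[1-1/]-mono {T} {T'} {X} {Y} {c} 1≤X X≤Y 0≤c (scaled T≡) (scaled T'≡) =
  *-cancelʳ-≤-fromℕ {X = X ℕ.* Y} (ℕP.*-mono-≤ 1≤X (ℕP.≤-trans 1≤X X≤Y)) (begin
  T * fromℕ (X ℕ.* Y)              ≡⟨ cong (T *_) (fromℕ-* X Y) ⟩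
  T * (fromℕ X * fromℕ Y)          ≡⟨ ℚP.*-assoc T (fromℕ X) (fromℕ Y) ⟨
  T * fromℕ X * fromℕ Y            ≡⟨ cong (_* fromℕ Y) T≡ ⟩
  (c * fromℕ X - c) * fromℕ Y      ≡⟨ expand₁ c (fromℕ X) (fromℕ Y) ⟩
  c * fromℕ X * fromℕ Y - c * fromℕ Y  ≤⟨ ℚP.+-monoʳ-≤ (c * fromℕ X * fromℕ Y) (ℚP.neg-antimono-≤ cX≤cY) ⟩
  c * fromℕ X * fromℕ Y - c * fromℕ X  ≡⟨ expand₂ c (fromℕ X) (fromℕ Y) ⟨
  (c * fromℕ Y - c) * fromℕ X      ≡⟨ cong (_* fromℕ X) T'≡ ⟨
  T' * fromℕ Y * fromℕ X           ≡⟨ ℚP.*-assoc T' (fromℕ Y) (fromℕ X) ⟩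
  T' * (fromℕ Y * fromℕ X)         ≡⟨ cong (T' *_) (trans (cong fromℕ (ℕP.*-comm X Y)) (fromℕ-* Y X)) ⟨
  T' * fromℕ (X ℕ.* Y)             ∎)
  where
  open ℚP.≤-Reasoning
  cX≤cY : c * fromℕ X ≤ c * fromℕ Y
  cX≤cY = ℚP.*-monoˡ-≤-nonNeg c {{ℚ.nonNegative 0≤c}} (fromℕ-mono-≤ {X} {Y} X≤Y)
  expand₁ : ∀ c X Y → (c * X - c) * Y ≡ c * X * Y - c * Y
  expand₁ = solve 3 (λ c X Y → (c :* X :- c) :* Y := c :* X :* Y :- c :* Y) refl
  expand₂ : ∀ c X Y → (c * Y - c) * X ≡ c * X * Y - c * X
  expand₂ = solve 3 (λ c X Y → (c :* Y :- c) :* X := c :* X :* Y :- c :* X) refl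

≡[1-1/]⇒∣ : ∀ {T X c E} → T ≡[1-1/ X ] fromℕ c → IsIntegral (T * fromℕ E) → X ∣ c ℕ.* E
≡[1-1/]⇒∣ {T} {X} {c} {E} (scaled T≡) (z , TE≡z) =
  divides ℤ.∣ + (c ℕ.* E) ℤ.- z ∣ (trans (cong ℤ.∣_∣ (fromℤ-injective {+ (c ℕ.* E)} {(+ (c ℕ.* E) ℤ.- z) ℤ.* + X} cE≡))
                                          (ℤP.abs-* (+ (c ℕ.* E) ℤ.- z) (+ X)))
  where
  cE≡ : fromℕ (c ℕ.* E) ≡ fromℤ ((+ (c ℕ.* E) ℤ.- z) ℤ.* + X)
  cE≡ = sym (begin
    fromℤ ((+ (c ℕ.* E) ℤ.- z) ℤ.* + X)             ≡⟨ fromℤ-* (+ (c ℕ.* E) ℤ.- z) (+ X) ⟩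
    fromℤ (+ (c ℕ.* E) ℤ.- z) * fromℕ X             ≡⟨ cong (_* fromℕ X) (fromℤ-minus (+ (c ℕ.* E)) z) ⟩
    (fromℕ (c ℕ.* E) - fromℤ z) * fromℕ X           ≡⟨ cong₂ (λ x y → (x - y) * fromℕ X) (fromℕ-* c E) (sym TE≡z) ⟩
    (fromℕ c * fromℕ E - T * fromℕ E) * fromℕ X     ≡⟨ regroup (fromℕ c) (fromℕ E) (fromℕ X) T ⟩
    fromℕ c * fromℕ E * fromℕ X - T * fromℕ X * fromℕ E  ≡⟨ cong (λ x → fromℕ c * fromℕ E * fromℕ X - x * fromℕ E) T≡ ⟩
    fromℕ c * fromℕ E * fromℕ X - (fromℕ c * fromℕ X - fromℕ c) * fromℕ E  ≡⟨ cancel (fromℕ c) (fromℕ E) (fromℕ X) ⟩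
    fromℕ c * fromℕ E                               ≡⟨ fromℕ-* c E ⟨
    fromℕ (c ℕ.* E)                                 ∎)
    where
    open ≡-Reasoning
    regroup : ∀ c E X T → (c * E - T * E) * X ≡ c * E * X - T * X * E
    regroup = solve 4 (λ c E X T → (c :* E :- T :* E) :* X := c :* E :* X :- T :* X :* E) refl
    cancel : ∀ c E X → c * E * X - (c * X - c) * E ≡ c * E
    cancel = solve 3 (λ c E X → c :* E :* X :- (c :* X :- c) :* E := c :* E) refl

residual-congruence : ∀ {T V X c P s} → T ≡[1-1/ X ] fromℕ c → IsIntegral (V * fromℕ P * fromℕ s) →
                      X ∣ℚ (T - V) * fromℕ P * fromℕ s * fromℕ X + fromℕ (c ℕ.* s ℕ.* P)
residual-congruence {T} {V} {X} {c} {P} {s} (scaled T≡) (a , VPs≡a) = + (c ℕ.* s ℕ.* P) ℤ.- a , (begin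
  (T - V) * fromℕ P * fromℕ s * fromℕ X + fromℕ (c ℕ.* s ℕ.* P)
    ≡⟨ cong (λ y → (T - V) * fromℕ P * fromℕ s * fromℕ X + y) csP≡ ⟩
  (T - V) * fromℕ P * fromℕ s * fromℕ X + fromℕ c * fromℕ s * fromℕ P
    ≡⟨ regroup T V (fromℕ P) (fromℕ s) (fromℕ X) (fromℕ c) ⟩
  T * fromℕ X * fromℕ s * fromℕ P - V * fromℕ P * fromℕ s * fromℕ X + fromℕ c * fromℕ s * fromℕ P
    ≡⟨ cong₂ (λ y z → y * fromℕ s * fromℕ P - z * fromℕ X + fromℕ c * fromℕ s * fromℕ P) T≡ VPs≡a ⟩
  (fromℕ c * fromℕ X - fromℕ c) * fromℕ s * fromℕ P - fromℤ a * fromℕ X + fromℕ c * fromℕ s * fromℕ P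
    ≡⟨ cancel (fromℕ c) (fromℕ X) (fromℕ s) (fromℕ P) (fromℤ a) ⟩
  (fromℕ c * fromℕ s * fromℕ P - fromℤ a) * fromℕ X
    ≡⟨ cong (λ y → (y - fromℤ a) * fromℕ X) csP≡ ⟨
  (fromℕ (c ℕ.* s ℕ.* P) - fromℤ a) * fromℕ X
    ≡⟨ cong (_* fromℕ X) (fromℤ-minus (+ (c ℕ.* s ℕ.* P)) a) ⟨
  fromℤ (+ (c ℕ.* s ℕ.* P) ℤ.- a) * fromℕ X ∎)
  where
  open ≡-Reasoning
  csP≡ : fromℕ (c ℕ.* s ℕ.* P) ≡ fromℕ c * fromℕ s * fromℕ P
  csP≡ = trans (fromℕ-* (c ℕ.* s) P) (cong (_* fromℕ P) (fromℕ-* c s))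
  regroup : ∀ T V P s X c → (T - V) * P * s * X + c * s * P ≡ T * X * s * P - V * P * s * X + c * s * P
  regroup = solve 6 (λ T V P s X c → (T :- V) :* P :* s :* X :+ c :* s :* P
                                     := T :* X :* s :* P :- V :* P :* s :* X :+ c :* s :* P) refl
  cancel : ∀ c X s P a → (c * X - c) * s * P - a * X + c * s * P ≡ (c * s * P - a) * X
  cancel = solve 5 (λ c X s P a → (c :* X :- c) :* s :* P :- a :* X :+ c :* s :* P := (c :* s :* P :- a) :* X) refl

1≤2^n : ∀ n → 1 ℕ.≤ 2 ^ n
1≤2^n n = ℕP.m^n>0 2 n

2^n≤3^n : ∀ n → 2 ^ n ℕ.≤ 3 ^ n
2^n≤3^n n = ℕP.^-monoˡ-≤ n (ℕP.n≤1+n 2)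

[2+n]*2^n≤2*3^n : ∀ n → (2 ℕ.+ n) ℕ.* 2 ^ n ℕ.≤ 2 ℕ.* 3 ^ n
[2+n]*2^n≤2*3^n zero    = ℕ.s≤s (ℕ.s≤s ℕ.z≤n)
[2+n]*2^n≤2*3^n (suc n) = begin
  (3 ℕ.+ n) ℕ.* (2 ℕ.* 2 ^ n)    ≡⟨ expand₁ n (2 ^ n) ⟩
  (6 ℕ.+ 2 ℕ.* n) ℕ.* 2 ^ n      ≤⟨ ℕP.*-monoˡ-≤ (2 ^ n) (ℕP.+-monoʳ-≤ 6 (ℕP.*-monoˡ-≤ n {2} {3} (ℕ.s≤s (ℕ.s≤s ℕ.z≤n)))) ⟩
  (6 ℕ.+ 3 ℕ.* n) ℕ.* 2 ^ n      ≡⟨ expand₂ n (2 ^ n) ⟩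
  3 ℕ.* ((2 ℕ.+ n) ℕ.* 2 ^ n)    ≤⟨ ℕP.*-monoʳ-≤ 3 ([2+n]*2^n≤2*3^n n) ⟩
  3 ℕ.* (2 ℕ.* 3 ^ n)            ≡⟨ expand₃ (3 ^ n) ⟩
  2 ℕ.* 3 ^ suc n                ∎
  where
  open ℕP.≤-Reasoning
  expand₁ : ∀ n x → (3 ℕ.+ n) ℕ.* (2 ℕ.* x) ≡ (6 ℕ.+ 2 ℕ.* n) ℕ.* x
  expand₁ = ℕ-solve-∀
  expand₂ : ∀ n x → (6 ℕ.+ 3 ℕ.* n) ℕ.* x ≡ 3 ℕ.* ((2 ℕ.+ n) ℕ.* x)
  expand₂ = ℕ-solve-∀
  expand₃ : ∀ x → 3 ℕ.* (2 ℕ.* x) ≡ 2 ℕ.* (3 ℕ.* x)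
  expand₃ = ℕ-solve-∀

K*2^n<3^n-eventually : ∀ K → ∃ λ M → ∀ {n} → M ℕ.≤ n → K ℕ.* 2 ^ n ℕ.< 3 ^ n
K*2^n<3^n-eventually K = M , λ M≤n → above (ℕP.≤⇒≤′ M≤n)
  where
  open ℕP.≤-Reasoning
  M = suc (2 ℕ.* K)
  base : K ℕ.* 2 ^ M ℕ.< 3 ^ M
  base = ℕP.*-cancelˡ-< 2 (K ℕ.* 2 ^ M) (3 ^ M) (begin-strict
    2 ℕ.* (K ℕ.* 2 ^ M)   ≡⟨ ℕP.*-assoc 2 K (2 ^ M) ⟨
    2 ℕ.* K ℕ.* 2 ^ M     <⟨ ℕP.*-monoˡ-< (2 ^ M) {{ℕ.>-nonZero (ℕP.m^n>0 2 M)}} (ℕP.m≤n+m M 2) ⟩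
    (2 ℕ.+ M) ℕ.* 2 ^ M   ≤⟨ [2+n]*2^n≤2*3^n M ⟩
    2 ℕ.* 3 ^ M           ∎)
  next : ∀ {n} → K ℕ.* 2 ^ n ℕ.< 3 ^ n → K ℕ.* 2 ^ suc n ℕ.< 3 ^ suc n
  next {n} lt = begin-strict
    K ℕ.* (2 ℕ.* 2 ^ n)   ≡⟨ ℕP.*-comm K (2 ℕ.* 2 ^ n) ⟩
    2 ℕ.* 2 ^ n ℕ.* K     ≡⟨ reorder (2 ^ n) ⟩
    2 ℕ.* (K ℕ.* 2 ^ n)   <⟨ ℕP.*-monoʳ-< 2 lt ⟩
    2 ℕ.* 3 ^ n           ≤⟨ ℕP.*-monoˡ-≤ (3 ^ n) (ℕP.n≤1+n 2) ⟩
    3 ℕ.* 3 ^ n           ∎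
    where
    reorder : ∀ x → 2 ℕ.* x ℕ.* K ≡ 2 ℕ.* (K ℕ.* x)
    reorder x = trans (ℕP.*-assoc 2 x K) (cong (2 ℕ.*_) (ℕP.*-comm x K))
  above : ∀ {n} → M ℕ.≤′ n → K ℕ.* 2 ^ n ℕ.< 3 ^ n
  above ℕ.≤′-refl                = base
  above {suc n} (ℕ.≤′-step M≤′n) = next {n} (above M≤′n)

Inherited : (ℕ → ℕ → ℕ) → (ℕ → Set) → Set
Inherited _⊕_ P = ∀ a b → (P a → P (a ⊕ b)) × (P b → P (a ⊕ b))

∀-inherited : ∀ {m _⊕_} (P : Fin m → ℕ → Set) → (∀ i → Inherited _⊕_ (P i)) → Inherited _⊕_ (λ a → ∀ i → P i a)
∀-inherited P inh a b = (λ Pa i → proj₁ (inh i a b) (Pa i)) , (λ Pb i → proj₂ (inh i a b) (Pb i))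

common-witness : ∀ {m} _⊕_ (P : Fin m → ℕ → Set) → (∀ i → Inherited _⊕_ (P i)) → (∀ i → ∃ (P i)) → ∃ λ a → ∀ i → P i a
common-witness {zero}  _⊕_ P inh ex = 0 , λ ()
common-witness {suc m} _⊕_ P inh ex with ex zero | common-witness _⊕_ (λ i → P (suc i)) (λ i → inh (suc i)) (λ i → ex (suc i))
... | a , Pa | b , Pb = a ⊕ b , λ { zero → proj₁ (inh zero a b) Pa ; (suc i) → proj₂ (inh (suc i) a b) (Pb i) }

weights-common-witness : ∀ {k} (C : NMDA k) _⊕_ (P : ℚ → ℕ → Set) → (∀ x → Inherited _⊕_ (P x)) → (∀ x → ∃ (P x)) →
                         ∃ λ a → ∀ p σ q → P (γ C p σ q) a
weights-common-witness C _⊕_ P inh ex =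
  common-witness _⊕_ (λ p a → ∀ σ q → P (γ C p σ q) a) (λ p → ∀-inherited _ λ σ → inh-q p σ) λ p →
  common-witness _⊕_ (λ σ a → ∀ q → P (γ C p σ q) a) (inh-q p) λ σ →
  common-witness _⊕_ (λ q → P (γ C p σ q)) (λ q → inh (γ C p σ q)) (λ q → ex (γ C p σ q))
  where
  inh-q : ∀ p σ → Inherited _⊕_ (λ a → ∀ q → P (γ C p σ q) a)
  inh-q p σ = ∀-inherited _ (λ q → inh (γ C p σ q))

weight-denominator : ∀ {k} (C : NMDA k) → ∃ λ d → ∀ p σ q → IsIntegral (γ C p σ q * fromℕ (suc d))
weight-denominator C = weights-common-witness C _⊕_ (λ x a → IsIntegral (x * fromℕ (suc a)))
  inh (λ x → ℚ.denominator-1 x , denominator-integral x)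
  where
  -- chosen so that suc (a ⊕ b) ≡ suc a ℕ.* suc b
  _⊕_ : ℕ → ℕ → ℕ
  a ⊕ b = a ℕ.+ b ℕ.* suc a
  rescale : ∀ x a b → x * fromℕ (suc a) * fromℕ (suc b) ≡ x * fromℕ (suc (a ⊕ b))
  rescale x a b = trans (reassoc x (fromℕ (suc a)) (fromℕ (suc b))) (cong (x *_) (sym (fromℕ-* (suc b) (suc a))))
    where
    reassoc : ∀ x A B → x * A * B ≡ x * (B * A)
    reassoc = solve 3 (λ x A B → x :* A :* B := x :* (B :* A)) refl
  inh : ∀ x → Inherited _⊕_ (λ a → IsIntegral (x * fromℕ (suc a)))
  inh x a b = (λ i → subst IsIntegral (rescale x a b) (*-integral i (fromℕ-integral (suc b))))
            , (λ i → subst IsIntegral (trans (swap x (fromℕ (suc b)) (fromℕ (suc a))) (rescale x a b))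
                                      (*-integral i (fromℕ-integral (suc a))))
    where
    swap : ∀ x A B → x * A * B ≡ x * B * A
    swap = solve 3 (λ x A B → x :* A :* B := x :* B :* A) refl

weight-bound : ∀ {k} (C : NMDA k) → ∃ λ G → ∀ p σ q → ℚ.∣ γ C p σ q ∣ ≤ fromℕ G
weight-bound C = weights-common-witness C ℕ._+_ (λ x G → ℚ.∣ x ∣ ≤ fromℕ G) inh (λ x → ℤ.∣ ℚ.↥ x ∣ , ∣q∣≤∣numerator∣ x)
  where
  inh : ∀ x → Inherited ℕ._+_ (λ G → ℚ.∣ x ∣ ≤ fromℕ G)
  inh x a b = (λ ∣x∣≤a → ℚP.≤-trans ∣x∣≤a (fromℕ-mono-≤ {a} {a ℕ.+ b} (ℕP.m≤m+n a b)))
            , (λ ∣x∣≤b → ℚP.≤-trans ∣x∣≤b (fromℕ-mono-≤ {b} {a ℕ.+ b} (ℕP.m≤n+m b a)))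

weight-upper-bound : ∀ {k} (C : NMDA k) → ∃ λ G → ∀ p σ q → γ C p σ q ≤ fromℕ G
weight-upper-bound C = let G , ∣γ∣≤G = weight-bound C in G , λ p σ q → ℚP.≤-trans (p≤∣p∣ (γ C p σ q)) (∣γ∣≤G p σ q)

integral-discount : ∀ {k} (C : NMDA k) → Integral C → ∀ {p σ q} → δ C p σ q ≡ true →
                    ∃ λ D → 2 ℕ.≤ D × invρ C p σ q * fromℕ D ≡ 1ℚ
integral-discount C IC {p} {σ} {q} t with IC p σ q t
... | z , ρ≡z = at z (fromℤ-cancel-< (subst (1ℚ <_) ρ≡z (ρ>1 C p σ q))) ρ≡z
  where
  inverse : invρ C p σ q * ρ C p σ q ≡ 1ℚ
  inverse = ℚP.*-inverseˡ (ρ C p σ q) {{ℚP.pos⇒nonZero (ρ C p σ q) {{ℚ.positive (ℚP.<-trans 0<1 (ρ>1 C p σ q))}}}}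
  at : ∀ z → + 1 ℤ.< z → ρ C p σ q ≡ fromℤ z → ∃ λ D → 2 ℕ.≤ D × invρ C p σ q * fromℕ D ≡ 1ℚ
  at (+ suc (suc m)) _ ρ≡z = suc (suc m) , ℕ.s≤s (ℕ.s≤s ℕ.z≤n) , trans (cong (invρ C p σ q *_) (sym ρ≡z)) inverse
  at (+ 1) (ℤ.+<+ (ℕ.s≤s ()))
  at (+ 0) (ℤ.+<+ ())

affine-rescale : ∀ g i v a b → i * a ≡ 1ℚ → (g + i * v) * (a * b) ≡ g * a * b + v * b
affine-rescale g i v a b i*a≡1 = begin
  (g + i * v) * (a * b)        ≡⟨ expand g i v a b ⟩
  g * a * b + i * a * (v * b)  ≡⟨ cong (λ x → g * a * b + x * (v * b)) i*a≡1 ⟩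
  g * a * b + 1ℚ * (v * b)     ≡⟨ cong (λ x → g * a * b + x) (ℚP.*-identityˡ (v * b)) ⟩
  g * a * b + v * b            ∎
  where
  open ≡-Reasoning
  expand : ∀ g i v a b → (g + i * v) * (a * b) ≡ g * a * b + i * a * (v * b)
  expand = solve 5 (λ g i v a b → (g :+ i :* v) :* (a :* b) := g :* a :* b :+ i :* a :* (v :* b)) refl

module IntegralRuns {k} (C : NMDA k) (IC : Integral C) where

  discount : ∀ {p σ q} → δ C p σ q ≡ true → ℕ
  discount t = proj₁ (integral-discount C IC t)

  2≤discount : ∀ {p σ q} (t : δ C p σ q ≡ true) → 2 ℕ.≤ discount t
  2≤discount t = proj₁ (proj₂ (integral-discount C IC t))

  invρ*discount≡1 : ∀ {p σ q} (t : δ C p σ q ≡ true) → invρ C p σ q * fromℕ (discount t) ≡ 1ℚ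
  invρ*discount≡1 t = proj₂ (proj₂ (integral-discount C IC t))

  scale : ∀ {q w v} → RunFrom C q w v → ℕ
  scale end        = 1
  scale (step t r) = discount t ℕ.* scale r

  1≤scale : ∀ {q w v} (r : RunFrom C q w v) → 1 ℕ.≤ scale r
  1≤scale end        = ℕ.s≤s ℕ.z≤n
  1≤scale (step t r) = ℕP.*-mono-≤ (ℕP.≤-trans (ℕ.s≤s ℕ.z≤n) (2≤discount t)) (1≤scale r)

  scaled-value-integral : ∀ D → (∀ p σ q → IsIntegral (γ C p σ q * fromℕ D)) →
                          ∀ {q w v} (r : RunFrom C q w v) → IsIntegral (v * fromℕ (scale r) * fromℕ D)
  scaled-value-integral D γD end = + 0 , trans (cong (_* fromℕ D) (ℚP.*-zeroˡ 1ℚ)) (ℚP.*-zeroˡ (fromℕ D))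
  scaled-value-integral D γD {p} (step {σ = σ} {q} {v = v} t r) = subst IsIntegral (sym eq)
    (+-integral (*-integral (*-integral (γD p σ q) (fromℕ-integral Z)) (fromℕ-integral P)) (scaled-value-integral D γD r))
    where
    Z P : ℕ
    Z = discount t
    P = scale r
    g i : ℚ
    g = γ C p σ q
    i = invρ C p σ q
    eq : (g + i * v) * fromℕ (Z ℕ.* P) * fromℕ D ≡ g * fromℕ D * fromℕ Z * fromℕ P + v * fromℕ P * fromℕ D
    eq = begin
      (g + i * v) * fromℕ (Z ℕ.* P) * fromℕ D                ≡⟨ cong (λ x → (g + i * v) * x * fromℕ D) (fromℕ-* Z P) ⟩
      (g + i * v) * (fromℕ Z * fromℕ P) * fromℕ D            ≡⟨ cong (_* fromℕ D) (affine-rescale g i v _ _ (invρ*discount≡1 t)) ⟩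
      (g * fromℕ Z * fromℕ P + v * fromℕ P) * fromℕ D         ≡⟨ distribute g (fromℕ Z) (fromℕ P) v (fromℕ D) ⟩
      g * fromℕ D * fromℕ Z * fromℕ P + v * fromℕ P * fromℕ D ∎
      where
      open ≡-Reasoning
      distribute : ∀ g Z P v D → (g * Z * P + v * P) * D ≡ g * D * Z * P + v * P * D
      distribute = solve 5 (λ g Z P v D → (g :* Z :* P :+ v :* P) :* D := g :* D :* Z :* P :+ v :* P :* D) refl

  run-extension : ∀ {B} → (∀ p σ q → γ C p σ q ≤ B) → ∀ {q w v} (r : RunFrom C q w v) σ →
                  ∃ λ v' → RunFrom C q (w ++ σ ∷ []) v' × v' * fromℕ (scale r) ≤ v * fromℕ (scale r) + B
  run-extension {B} γ≤B {q} end σ with complete C q σ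
  ... | q' , t = _ , step t end ,
    subst₂ _≤_ (sym (single-step (γ C q σ q') (invρ C q σ q'))) (sym (ℚP.+-identityˡ B)) (γ≤B q σ q')
    where
    single-step : ∀ g i → (g + i * 0ℚ) * 1ℚ ≡ g
    single-step = solve 2 (λ g i → (g :+ i :* con 0ℚ) :* con 1ℚ := g) refl
  run-extension {B} γ≤B {p} (step {σ = σ} {q} {v = v} t r) σ' =
    let v' , r' , v'≤ = run-extension γ≤B r σ' in _ , step t r' , prepend v'≤
    where
    Z P : ℕ
    Z = discount t
    P = scale r
    g i : ℚ
    g = γ C p σ q
    i = invρ C p σ q
    rescale : ∀ x → (g + i * x) * fromℕ (Z ℕ.* P) ≡ g * fromℕ Z * fromℕ P + x * fromℕ P
    rescale x = trans (cong ((g + i * x) *_) (fromℕ-* Z P)) (affine-rescale g i x (fromℕ Z) (fromℕ P) (invρ*discount≡1 t))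
    prepend : ∀ {v'} → v' * fromℕ P ≤ v * fromℕ P + B → (g + i * v') * fromℕ (Z ℕ.* P) ≤ (g + i * v) * fromℕ (Z ℕ.* P) + B
    prepend {v'} v'≤ = begin
      (g + i * v') * fromℕ (Z ℕ.* P)             ≡⟨ rescale v' ⟩
      g * fromℕ Z * fromℕ P + v' * fromℕ P       ≤⟨ ℚP.+-monoʳ-≤ (g * fromℕ Z * fromℕ P) v'≤ ⟩
      g * fromℕ Z * fromℕ P + (v * fromℕ P + B)  ≡⟨ ℚP.+-assoc (g * fromℕ Z * fromℕ P) (v * fromℕ P) B ⟨
      g * fromℕ Z * fromℕ P + v * fromℕ P + B    ≡⟨ cong (_+ B) (rescale v) ⟨
      (g + i * v) * fromℕ (Z ℕ.* P) + B          ∎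
      where open ℚP.≤-Reasoning

Path : ∀ {k} (C : NMDA k) → (ℕ → Fin k) → (ℕ → Fin (n C)) → Set
Path C w r = ∀ i → δ C (r i) (w i) (r (suc i)) ≡ true

shift : ∀ {A : Set} → (ℕ → A) → ℕ → ℕ → A
shift f m j = f (j ℕ.+ m)

splice : ∀ {A : Set} → (ℕ → A) → ℕ → (ℕ → A) → ℕ → A
splice f zero    g i       = g i
splice f (suc m) g zero    = f zero
splice f (suc m) g (suc i) = splice (λ j → f (suc j)) m g i

splice-< : ∀ {A : Set} (f : ℕ → A) m g {i} → i ℕ.< m → splice f m g i ≡ f i
splice-< f (suc m) g {zero}  _             = refl
splice-< f (suc m) g {suc i} (ℕ.s≤s i<m) = splice-< (λ j → f (suc j)) m g i<m

splice-+ : ∀ {A : Set} (f : ℕ → A) m g j → splice f m g (j ℕ.+ m) ≡ g j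
splice-+ f zero    g j = cong g (ℕP.+-identityʳ j)
splice-+ f (suc m) g j rewrite ℕP.+-suc j m = splice-+ (λ i → f (suc i)) m g j

splice-≤ : ∀ {A : Set} (f : ℕ → A) m g → g 0 ≡ f m → ∀ {i} → i ℕ.≤ m → splice f m g i ≡ f i
splice-≤ f m g g0≡fm {i} i≤m with ℕP.m≤n⇒m<n∨m≡n i≤m
... | inj₁ i<m  = splice-< f m g i<m
... | inj₂ refl = trans (splice-+ f m g 0) g0≡fm

module InfiniteRuns {k} (C : NMDA k) where

  0<invρ : ∀ p σ q → 0ℚ < invρ C p σ q
  0<invρ p σ q = ℚP.positive⁻¹ _ {{ℚP.1/pos⇒pos (ρ C p σ q) {{ℚ.positive (ℚP.<-trans 0<1 (ρ>1 C p σ q))}}}}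

  0≤invDisc : ∀ w r i → 0ℚ ≤ invDisc C w r i
  0≤invDisc w r zero    = ℚP.<⇒≤ 0<1
  0≤invDisc w r (suc i) = subst (_≤ invDisc C w r i * inv) (ℚP.*-zeroˡ inv)
    (ℚP.*-monoʳ-≤-nonNeg inv {{ℚ.nonNegative (ℚP.<⇒≤ (0<invρ (r i) (w i) (r (suc i))))}} (0≤invDisc w r i))
    where
    inv : ℚ
    inv = invρ C (r i) (w i) (r (suc i))

  invDisc-+ : ∀ w r m j → invDisc C w r (j ℕ.+ m) ≡ invDisc C w r m * invDisc C (shift w m) (shift r m) j
  invDisc-+ w r m zero    = sym (ℚP.*-identityʳ (invDisc C w r m))
  invDisc-+ w r m (suc j) = trans (cong (_* inv) (invDisc-+ w r m j))
                                  (ℚP.*-assoc (invDisc C w r m) (invDisc C (shift w m) (shift r m) j) inv)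
    where
    inv : ℚ
    inv = invρ C (r (j ℕ.+ m)) (w (j ℕ.+ m)) (r (suc j ℕ.+ m))

  partial-+ : ∀ w r m j → partial C w r (j ℕ.+ m) ≡ partial C w r m + invDisc C w r m * partial C (shift w m) (shift r m) j
  partial-+ w r m zero    = sym (trans (cong (λ x → partial C w r m + x) (ℚP.*-zeroʳ (invDisc C w r m))) (ℚP.+-identityʳ _))
  partial-+ w r m (suc j) = begin
    p' + g * invDisc C w r (j ℕ.+ m)   ≡⟨ cong₂ (λ a b → a + g * b) (partial-+ w r m j) (invDisc-+ w r m j) ⟩
    p + d * t + g * (d * e)            ≡⟨ regroup p d t g e ⟩
    p + d * (t + g * e)                ∎
    where
    open ≡-Reasoning
    p' g p d t : ℚ
    p' = partial C w r (j ℕ.+ m)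
    g = γ C (r (j ℕ.+ m)) (w (j ℕ.+ m)) (r (suc j ℕ.+ m))
    p = partial C w r m
    d = invDisc C w r m
    t = partial C (shift w m) (shift r m) j
    e = invDisc C (shift w m) (shift r m) j
    regroup : ∀ p d t g e → p + d * t + g * (d * e) ≡ p + d * (t + g * e)
    regroup = solve 5 (λ p d t g e → p :+ d :* t :+ g :* (d :* e) := p :+ d :* (t :+ g :* e)) refl

  prefix-cong : ∀ {w w' r r'} M → (∀ i → i ℕ.< M → w i ≡ w' i) → (∀ i → i ℕ.≤ M → r i ≡ r' i) →
                partial C w r M ≡ partial C w' r' M × invDisc C w r M ≡ invDisc C w' r' M
  prefix-cong zero    _  _  = refl , refl
  prefix-cong {w} {w'} {r} {r'} (suc M) w≡ r≡
    with prefix-cong M (λ i i<M → w≡ i (ℕP.m<n⇒m<1+n i<M)) (λ i i≤M → r≡ i (ℕP.m≤n⇒m≤1+n i≤M))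
  ... | p≡ , d≡ rewrite w≡ M ℕP.≤-refl | r≡ M (ℕP.n≤1+n M) | r≡ (suc M) ℕP.≤-refl | p≡ | d≡ = refl , refl

  path-from : Fin (n C) → (ℕ → Fin k) → ℕ → Fin (n C)
  path-from q u zero    = q
  path-from q u (suc i) = proj₁ (complete C (path-from q u i) (u i))

  path-from-path : ∀ q u → Path C u (path-from q u)
  path-from-path q u i = proj₂ (complete C (path-from q u i) (u i))

  shift-path : ∀ {w r} → Path C w r → ∀ m → Path C (shift w m) (shift r m)
  shift-path path m j = path (j ℕ.+ m)

  module Graft {w w' u : ℕ → Fin k} {r s : ℕ → Fin (n C)} {m : ℕ}
               (w'-prefix : ∀ i → i ℕ.< m → w' i ≡ w i) (w'-suffix : ∀ j → w' (j ℕ.+ m) ≡ u j) (s0≡rm : s 0 ≡ r m) where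

    graft-run : IsRun C w r → Path C u s → IsRun C w' (splice r m s)
    graft-run (ι-r0 , r-path) s-path = subst (λ q → ι C q ≡ true) (sym (splice-≤ r m s s0≡rm ℕ.z≤n)) ι-r0 , transition
      where
      transition : ∀ i → δ C (splice r m s i) (w' i) (splice r m s (suc i)) ≡ true
      transition i with ℕP.≤-<-connex m i
      ... | inj₂ i<m = subst₂ (λ p q → δ C p (w' i) q ≡ true) (sym (splice-< r m s i<m)) (sym (splice-≤ r m s s0≡rm i<m))
                              (subst (λ σ → δ C (r i) σ (r (suc i)) ≡ true) (sym (w'-prefix i i<m)) (r-path i))
      ... | inj₁ m≤i = subst (λ i → δ C (splice r m s i) (w' i) (splice r m s (suc i)) ≡ true)
                             (ℕP.m∸n+n≡m m≤i) (suffix (i ℕ.∸ m))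
        where
        suffix : ∀ j → δ C (splice r m s (j ℕ.+ m)) (w' (j ℕ.+ m)) (splice r m s (suc j ℕ.+ m)) ≡ true
        suffix j rewrite splice-+ r m s j | splice-+ r m s (suc j) | w'-suffix j = s-path j

    graft-partial : ∀ j → partial C w' (splice r m s) (j ℕ.+ m) ≡ partial C w r m + invDisc C w r m * partial C u s j
    graft-partial j = begin
      partial C w' g (j ℕ.+ m)                                              ≡⟨ partial-+ w' g m j ⟩
      partial C w' g m + invDisc C w' g m * partial C (shift w' m) (shift g m) j
        ≡⟨ cong₂ (λ p d → p + d * partial C (shift w' m) (shift g m) j) (proj₁ prefix≡) (proj₂ prefix≡) ⟩
      partial C w r m + invDisc C w r m * partial C (shift w' m) (shift g m) j
        ≡⟨ cong (λ t → partial C w r m + invDisc C w r m * t) (proj₁ suffix≡) ⟩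
      partial C w r m + invDisc C w r m * partial C u s j                   ∎
      where
      open ≡-Reasoning
      g : ℕ → Fin (n C)
      g = splice r m s
      prefix≡ : partial C w' g m ≡ partial C w r m × invDisc C w' g m ≡ invDisc C w r m
      prefix≡ = prefix-cong m w'-prefix (λ i → splice-≤ r m s s0≡rm)
      suffix≡ : partial C (shift w' m) (shift g m) j ≡ partial C u s j × invDisc C (shift w' m) (shift g m) j ≡ invDisc C u s j
      suffix≡ = prefix-cong j (λ i _ → w'-suffix i) (λ i _ → splice-+ r m s i)

module IntegralPaths {k} (C : NMDA k) (IC : Integral C) where
  open IntegralRuns C IC using (discount; 2≤discount; invρ*discount≡1)
  open InfiniteRuns C using (0<invρ; 0≤invDisc)

  path-scale : ∀ {w r} → Path C w r → ℕ → ℕ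
  path-scale path zero    = 1
  path-scale path (suc i) = path-scale path i ℕ.* discount (path i)

  invDisc*path-scale≡1 : ∀ {w r} (path : Path C w r) i → invDisc C w r i * fromℕ (path-scale path i) ≡ 1ℚ
  invDisc*path-scale≡1 path zero = refl
  invDisc*path-scale≡1 {w} {r} path (suc i) = begin
    d * inv * fromℕ (P ℕ.* Z)        ≡⟨ cong (d * inv *_) (fromℕ-* P Z) ⟩
    d * inv * (fromℕ P * fromℕ Z)    ≡⟨ interchange d inv (fromℕ P) (fromℕ Z) ⟩
    (d * fromℕ P) * (inv * fromℕ Z)  ≡⟨ cong₂ _*_ (invDisc*path-scale≡1 path i) (invρ*discount≡1 (path i)) ⟩
    1ℚ                               ∎
    where
    open ≡-Reasoning
    d inv : ℚ
    d = invDisc C w r i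
    inv = invρ C (r i) (w i) (r (suc i))
    P Z : ℕ
    P = path-scale path i
    Z = discount (path i)
    interchange : ∀ a b c d → a * b * (c * d) ≡ (a * c) * (b * d)
    interchange = solve 4 (λ a b c d → a :* b :* (c :* d) := (a :* c) :* (b :* d)) refl

  2^i≤path-scale : ∀ {w r} (path : Path C w r) i → 2 ^ i ℕ.≤ path-scale path i
  2^i≤path-scale path zero    = ℕP.≤-refl
  2^i≤path-scale path (suc i) = ℕP.≤-trans (ℕP.≤-reflexive (ℕP.*-comm 2 (2 ^ i)))
                                           (ℕP.*-mono-≤ (2^i≤path-scale path i) (2≤discount (path i)))

  scaled-partial-integral : ∀ D → (∀ p σ q → IsIntegral (γ C p σ q * fromℕ D)) →
                            ∀ {w r} (path : Path C w r) i → IsIntegral (partial C w r i * fromℕ (path-scale path i) * fromℕ D)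
  scaled-partial-integral D γD path zero = + 0 , trans (cong (_* fromℕ D) (ℚP.*-zeroˡ 1ℚ)) (ℚP.*-zeroˡ (fromℕ D))
  scaled-partial-integral D γD {w} {r} path (suc i) = subst IsIntegral (sym eq)
    (+-integral (*-integral (scaled-partial-integral D γD path i) (fromℕ-integral Z))
                (*-integral (γD (r i) (w i) (r (suc i))) (fromℕ-integral Z)))
    where
    p d g : ℚ
    p = partial C w r i
    d = invDisc C w r i
    g = γ C (r i) (w i) (r (suc i))
    P Z : ℕ
    P = path-scale path i
    Z = discount (path i)
    eq : (p + g * d) * fromℕ (P ℕ.* Z) * fromℕ D ≡ p * fromℕ P * fromℕ D * fromℕ Z + g * fromℕ D * fromℕ Z
    eq = begin
      (p + g * d) * fromℕ (P ℕ.* Z) * fromℕ D                 ≡⟨ cong (λ x → (p + g * d) * x * fromℕ D) (fromℕ-* P Z) ⟩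
      (p + g * d) * (fromℕ P * fromℕ Z) * fromℕ D             ≡⟨ expand p g d (fromℕ P) (fromℕ Z) (fromℕ D) ⟩
      p * fromℕ P * fromℕ D * fromℕ Z + g * fromℕ D * fromℕ Z * (d * fromℕ P)
        ≡⟨ cong (λ x → p * fromℕ P * fromℕ D * fromℕ Z + g * fromℕ D * fromℕ Z * x) (invDisc*path-scale≡1 path i) ⟩
      p * fromℕ P * fromℕ D * fromℕ Z + g * fromℕ D * fromℕ Z * 1ℚ
        ≡⟨ cong (λ x → p * fromℕ P * fromℕ D * fromℕ Z + x) (ℚP.*-identityʳ _) ⟩
      p * fromℕ P * fromℕ D * fromℕ Z + g * fromℕ D * fromℕ Z ∎
      where
      open ≡-Reasoning
      expand : ∀ p g d P Z D → (p + g * d) * (P * Z) * D ≡ p * P * D * Z + g * D * Z * (d * P)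
      expand = solve 6 (λ p g d P Z D → (p :+ g :* d) :* (P :* Z) :* D := p :* P :* D :* Z :+ g :* D :* Z :* (d :* P)) refl

  invρ*2≤1 : ∀ {p σ q} → δ C p σ q ≡ true → invρ C p σ q * fromℕ 2 ≤ 1ℚ
  invρ*2≤1 {p} {σ} {q} t = ℚP.≤-trans (ℚP.*-monoˡ-≤-nonNeg (invρ C p σ q) {{ℚ.nonNegative (ℚP.<⇒≤ (0<invρ p σ q))}}
                                          (fromℕ-mono-≤ {2} {discount t} (2≤discount t)))
                                       (ℚP.≤-reflexive (invρ*discount≡1 t))

  module _ {G} (∣γ∣≤G : ∀ p σ q → ℚ.∣ γ C p σ q ∣ ≤ fromℕ G) where

    private
      B : ℚ
      B = fromℕ G
      0≤B : 0ℚ ≤ B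
      0≤B = fromℕ-nonNeg G

    partial-invariant : ∀ {w r} → Path C w r → ∀ i →
                        ℚ.∣ partial C w r i ∣ + fromℕ 2 * fromℕ G * invDisc C w r i ≤ fromℕ 2 * fromℕ G
    partial-invariant path zero = ℚP.≤-reflexive (trans (ℚP.+-identityˡ _) (ℚP.*-identityʳ _))
    partial-invariant {w} {r} path (suc i) = begin
      ℚ.∣ p + g * d ∣ + fromℕ 2 * B * (d * inv)          ≤⟨ ℚP.+-monoˡ-≤ _ (ℚP.∣p+q∣≤∣p∣+∣q∣ p (g * d)) ⟩
      ℚ.∣ p ∣ + ℚ.∣ g * d ∣ + fromℕ 2 * B * (d * inv)    ≡⟨ cong (λ x → ℚ.∣ p ∣ + x + fromℕ 2 * B * (d * inv)) ∣g*d∣≡ ⟩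
      ℚ.∣ p ∣ + ℚ.∣ g ∣ * d + fromℕ 2 * B * (d * inv)    ≡⟨ regroup ℚ.∣ p ∣ ℚ.∣ g ∣ d B inv ⟩
      ℚ.∣ p ∣ + ℚ.∣ g ∣ * d + B * d * (inv * fromℕ 2)    ≤⟨ ℚP.+-mono-≤ (ℚP.+-monoʳ-≤ ℚ.∣ p ∣ ∣g∣d≤Bd) Bd[2inv]≤Bd ⟩
      ℚ.∣ p ∣ + B * d + B * d * 1ℚ                       ≡⟨ collect ℚ.∣ p ∣ B d ⟩
      ℚ.∣ p ∣ + fromℕ 2 * B * d                          ≤⟨ partial-invariant path i ⟩
      fromℕ 2 * B                                        ∎
      where
      open ℚP.≤-Reasoning
      p d g inv : ℚ
      p = partial C w r i
      d = invDisc C w r i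
      g = γ C (r i) (w i) (r (suc i))
      inv = invρ C (r i) (w i) (r (suc i))
      0≤d : 0ℚ ≤ d
      0≤d = 0≤invDisc w r i
      ∣g*d∣≡ : ℚ.∣ g * d ∣ ≡ ℚ.∣ g ∣ * d
      ∣g*d∣≡ = trans (ℚP.∣p*q∣≡∣p∣*∣q∣ g d) (cong (ℚ.∣ g ∣ *_) (ℚP.0≤p⇒∣p∣≡p 0≤d))
      ∣g∣d≤Bd : ℚ.∣ g ∣ * d ≤ B * d
      ∣g∣d≤Bd = ℚP.*-monoʳ-≤-nonNeg d {{ℚ.nonNegative 0≤d}} (∣γ∣≤G (r i) (w i) (r (suc i)))
      Bd[2inv]≤Bd : B * d * (inv * fromℕ 2) ≤ B * d * 1ℚ
      Bd[2inv]≤Bd = ℚP.*-monoˡ-≤-nonNeg (B * d) {{ℚ.nonNegative (*-nonNeg 0≤B 0≤d)}} (invρ*2≤1 (path i))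
      regroup : ∀ p g d B i → p + g * d + fromℕ 2 * B * (d * i) ≡ p + g * d + B * d * (i * fromℕ 2)
      regroup = solve 5 (λ p g d B i → p :+ g :* d :+ con (fromℕ 2) :* B :* (d :* i)
                                     := p :+ g :* d :+ B :* d :* (i :* con (fromℕ 2))) refl
      collect : ∀ p B d → p + B * d + B * d * 1ℚ ≡ p + fromℕ 2 * B * d
      collect = solve 3 (λ p B d → p :+ B :* d :+ B :* d :* con 1ℚ := p :+ con (fromℕ 2) :* B :* d) refl

    ∣partial∣≤2G : ∀ {w r} → Path C w r → ∀ i → ℚ.∣ partial C w r i ∣ ≤ fromℕ 2 * fromℕ G
    ∣partial∣≤2G {w} {r} path i = ℚP.≤-trans (ℚP.≤-trans (ℚP.≤-reflexive (sym (ℚP.+-identityʳ _)))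
                                   (ℚP.+-monoʳ-≤ ℚ.∣ partial C w r i ∣ 0≤2Bd)) (partial-invariant path i)
      where
      0≤2Bd : 0ℚ ≤ fromℕ 2 * B * invDisc C w r i
      0≤2Bd = *-nonNeg (*-nonNeg (fromℕ-nonNeg 2) 0≤B) (0≤invDisc w r i)

-- Finite words

gap-vs-increment : ∀ {T T' X P g B} → 0ℚ ≤ X → 0ℚ ≤ P →
                   T * X + g ≤ T' * X → T' * P ≤ T * P + B → g * P ≤ B * X
gap-vs-increment {T} {T'} {X} {P} {g} {B} 0≤X 0≤P gap increment = +-cancelʳ-≤ (T * X * P) (begin
  g * P + T * X * P    ≡⟨ expand₁ g P T X ⟩
  (T * X + g) * P      ≤⟨ ℚP.*-monoʳ-≤-nonNeg P {{ℚ.nonNegative 0≤P}} gap ⟩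
  T' * X * P           ≡⟨ swap T' X P ⟩
  T' * P * X           ≤⟨ ℚP.*-monoʳ-≤-nonNeg X {{ℚ.nonNegative 0≤X}} increment ⟩
  (T * P + B) * X      ≡⟨ expand₂ T P B X ⟩
  B * X + T * X * P    ∎)
  where
  open ℚP.≤-Reasoning
  expand₁ : ∀ g P T X → g * P + T * X * P ≡ (T * X + g) * P
  expand₁ = solve 4 (λ g P T X → g :* P :+ T :* X :* P := (T :* X :+ g) :* P) refl
  swap : ∀ T X P → T * X * P ≡ T * P * X
  swap = solve 3 (λ T X P → T :* X :* P := T :* P :* X) refl
  expand₂ : ∀ T P B X → (T * P + B) * X ≡ B * X + T * X * P
  expand₂ = solve 4 (λ T P B X → (T :* P :+ B) :* X := B :* X :+ T :* X :* P) refl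

FiniteGap : ∀ {k} → NMDA k → ℕ → Set
FiniteGap C n = ∃ λ w → ∃ λ σ → ∃ λ T → ∃ λ T' →
  ValueIs C w T × ValueIs C (w ++ σ ∷ []) T' ×
  T ≡[1-1/ 3 ^ n ] fromℕ 6 × T * fromℕ (2 ^ n) + fromℕ 6 ≤ T' * fromℕ (2 ^ n)

finite-gap-bound : ∀ {k} (C : NMDA k) → Integral C → ∀ {d G} →
                   (∀ p σ q → IsIntegral (γ C p σ q * fromℕ (suc d))) → (∀ p σ q → γ C p σ q ≤ fromℕ G) →
                   ∀ {n} → FiniteGap C n → 3 ^ n ℕ.≤ suc d ℕ.* G ℕ.* 2 ^ n
finite-gap-bound C IC {d} {G} γD γ≤G {n} (w , σ , T , T' , ((q , ι-q , r) , _) , (_ , T'-minimal) , T≡ , gap) = begin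
  3 ^ n                      ≤⟨ ∣⇒≤ {{ℕ.>-nonZero 0<6PD}} (≡[1-1/]⇒∣ {T} {3 ^ n} {6} {P ℕ.* suc d} T≡ TPD-integral) ⟩
  6 ℕ.* (P ℕ.* suc d)        ≡⟨ ℕP.*-assoc 6 P (suc d) ⟨
  6 ℕ.* P ℕ.* suc d          ≤⟨ ℕP.*-monoˡ-≤ (suc d) 6P≤G2^n ⟩
  G ℕ.* 2 ^ n ℕ.* suc d      ≡⟨ ℕP.*-comm (G ℕ.* 2 ^ n) (suc d) ⟩
  suc d ℕ.* (G ℕ.* 2 ^ n)    ≡⟨ ℕP.*-assoc (suc d) G (2 ^ n) ⟨
  suc d ℕ.* G ℕ.* 2 ^ n      ∎
  where
  open ℕP.≤-Reasoning
  open IntegralRuns C IC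
  P : ℕ
  P = scale r
  0<6PD : 0 ℕ.< 6 ℕ.* (P ℕ.* suc d)
  0<6PD = ℕP.*-mono-≤ {1} {6} (ℕ.s≤s ℕ.z≤n) (ℕP.*-mono-≤ (1≤scale r) (ℕ.s≤s ℕ.z≤n))
  TPD-integral : IsIntegral (T * fromℕ (P ℕ.* suc d))
  TPD-integral = subst IsIntegral (trans (ℚP.*-assoc T (fromℕ P) (fromℕ (suc d))) (cong (T *_) (sym (fromℕ-* P (suc d)))))
                       (scaled-value-integral (suc d) γD r)
  extension : ∃ λ v' → RunFrom C q (w ++ σ ∷ []) v' × v' * fromℕ P ≤ T * fromℕ P + fromℕ G
  extension = run-extension γ≤G r σ
  T'P≤TP+G : T' * fromℕ P ≤ T * fromℕ P + fromℕ G
  T'P≤TP+G = ℚP.≤-trans (ℚP.*-monoʳ-≤-nonNeg (fromℕ P) {{ℚ.nonNegative (fromℕ-nonNeg P)}}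
                           (T'-minimal _ (q , ι-q , proj₁ (proj₂ extension))))
                        (proj₂ (proj₂ extension))
  6P≤G2^n : 6 ℕ.* P ℕ.≤ G ℕ.* 2 ^ n
  6P≤G2^n = fromℕ-cancel-≤ {6 ℕ.* P} {G ℕ.* 2 ^ n} (subst₂ _≤_ (sym (fromℕ-* 6 P)) (sym (fromℕ-* G (2 ^ n)))
    (gap-vs-increment {T} {T'} {fromℕ (2 ^ n)} {fromℕ P} {fromℕ 6} {fromℕ G}
                      (fromℕ-nonNeg (2 ^ n)) (fromℕ-nonNeg P) gap T'P≤TP+G))

no-integral-finite-gaps : ∀ {k} (C : NMDA k) → Integral C → (∀ n → FiniteGap C (suc n)) → ⊥
no-integral-finite-gaps C IC gaps =
  let d , γd   = weight-denominator C
      G , γ≤G  = weight-upper-bound C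
      M , 3^n-wins = K*2^n<3^n-eventually (suc d ℕ.* G)
  in ℕP.<⇒≱ (3^n-wins (ℕP.n≤1+n M)) (finite-gap-bound C IC {d} {G} γd γ≤G {suc M} (gaps M))

-- Infinite words

graft-gap : ∀ {T s' V d τ τ' e X} → 0ℚ ≤ X → T * X + fromℕ 6 ≤ s' * X →
            s' ≤ V + d * τ' + e → V + d * τ ≤ T + e + e → e * X ≤ 1ℚ → fromℕ 3 ≤ d * (τ' - τ) * X
graft-gap {T} {s'} {V} {d} {τ} {τ'} {e} {X} 0≤X gap s'≤ V+dτ≤ eX≤1 = +-cancelʳ-≤ (T * X + fromℕ 3) (begin
  fromℕ 3 + (T * X + fromℕ 3)                  ≡⟨ split-six (T * X) ⟩
  T * X + fromℕ 6                              ≤⟨ gap ⟩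
  s' * X                                       ≤⟨ ℚP.*-monoʳ-≤-nonNeg X {{ℚ.nonNegative 0≤X}} s'≤T+3e+Δ ⟩
  (T + e + e + d * (τ' - τ) + e) * X           ≡⟨ expand T e d τ τ' X ⟩
  d * (τ' - τ) * X + (T * X + fromℕ 3 * (e * X))  ≤⟨ ℚP.+-monoʳ-≤ (d * (τ' - τ) * X) (ℚP.+-monoʳ-≤ (T * X) 3eX≤3) ⟩
  d * (τ' - τ) * X + (T * X + fromℕ 3)         ∎)
  where
  open ℚP.≤-Reasoning
  split-six : ∀ y → fromℕ 3 + (y + fromℕ 3) ≡ y + fromℕ 6
  split-six = solve 1 (λ y → con (fromℕ 3) :+ (y :+ con (fromℕ 3)) := y :+ con (fromℕ 6)) refl
  expand : ∀ T e d τ τ' X → (T + e + e + d * (τ' - τ) + e) * X ≡ d * (τ' - τ) * X + (T * X + fromℕ 3 * (e * X))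
  expand = solve 6 (λ T e d τ τ' X → (T :+ e :+ e :+ d :* (τ' :- τ) :+ e) :* X
                                    := d :* (τ' :- τ) :* X :+ (T :* X :+ con (fromℕ 3) :* (e :* X))) refl
  shuffle : ∀ V d τ τ' e → V + d * τ' + e ≡ V + d * τ + d * (τ' - τ) + e
  shuffle = solve 5 (λ V d τ τ' e → V :+ d :* τ' :+ e := V :+ d :* τ :+ d :* (τ' :- τ) :+ e) refl
  s'≤T+3e+Δ : s' ≤ T + e + e + d * (τ' - τ) + e
  s'≤T+3e+Δ = ℚP.≤-trans s'≤ (ℚP.≤-trans (ℚP.≤-reflexive (shuffle V d τ τ' e))
                (ℚP.+-monoˡ-≤ e (ℚP.+-monoˡ-≤ (d * (τ' - τ)) V+dτ≤)))
  3eX≤3 : fromℕ 3 * (e * X) ≤ fromℕ 3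
  3eX≤3 = ℚP.≤-trans (ℚP.*-monoˡ-≤-nonNeg (fromℕ 3) {{ℚ.nonNegative (fromℕ-nonNeg 3)}} eX≤1)
                     (ℚP.≤-reflexive (ℚP.*-identityʳ (fromℕ 3)))

swap-gap : ∀ {T₁ V₁ d₁ P₁ T₂ V₂ d₂ P₂ τ e} → d₁ * P₁ ≡ 1ℚ → d₂ * P₂ ≡ 1ℚ → 0ℚ ≤ P₁ → 0ℚ ≤ P₂ →
           T₁ ≤ V₁ + d₁ * τ + e → V₂ + d₂ * τ ≤ T₂ + e + e →
           (T₁ - V₁) * P₁ ≤ (T₂ - V₂) * P₂ + e * (P₁ + fromℕ 2 * P₂)
swap-gap {T₁} {V₁} {d₁} {P₁} {T₂} {V₂} {d₂} {P₂} {τ} {e} d₁P₁≡1 d₂P₂≡1 0≤P₁ 0≤P₂ T₁≤ V₂+d₂τ≤ = begin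
  (T₁ - V₁) * P₁                            ≤⟨ ℚP.*-monoʳ-≤-nonNeg P₁ {{ℚ.nonNegative 0≤P₁}} (move-left T₁≤) ⟩
  (d₁ * τ + e) * P₁                         ≡⟨ unscale d₁ τ e P₁ ⟩
  τ * (d₁ * P₁) + e * P₁                    ≡⟨ cong (λ x → τ * x + e * P₁) (trans d₁P₁≡1 (sym d₂P₂≡1)) ⟩
  τ * (d₂ * P₂) + e * P₁                    ≡⟨ regroup τ d₂ P₂ e P₁ ⟩
  (d₂ * τ) * P₂ + e * P₁
    ≤⟨ ℚP.+-monoˡ-≤ (e * P₁) (ℚP.*-monoʳ-≤-nonNeg P₂ {{ℚ.nonNegative 0≤P₂}} (move-right V₂+d₂τ≤)) ⟩
  (T₂ + e + e - V₂) * P₂ + e * P₁           ≡⟨ collect T₂ V₂ P₂ e P₁ ⟩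
  (T₂ - V₂) * P₂ + e * (P₁ + fromℕ 2 * P₂)  ∎
  where
  open ℚP.≤-Reasoning
  unscale : ∀ d τ e P → (d * τ + e) * P ≡ τ * (d * P) + e * P
  unscale = solve 4 (λ d τ e P → (d :* τ :+ e) :* P := τ :* (d :* P) :+ e :* P) refl
  regroup : ∀ τ d P e P₁ → τ * (d * P) + e * P₁ ≡ (d * τ) * P + e * P₁
  regroup = solve 5 (λ τ d P e P₁ → τ :* (d :* P) :+ e :* P₁ := (d :* τ) :* P :+ e :* P₁) refl
  collect : ∀ T V P e P₁ → (T + e + e - V) * P + e * P₁ ≡ (T - V) * P + e * (P₁ + fromℕ 2 * P)
  collect = solve 5 (λ T V P e P₁ → (T :+ e :+ e :- V) :* P :+ e :* P₁ := (T :- V) :* P :+ e :* (P₁ :+ con (fromℕ 2) :* P)) refl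
  move-left : T₁ ≤ V₁ + d₁ * τ + e → T₁ - V₁ ≤ d₁ * τ + e
  move-left le = ℚP.≤-trans (ℚP.+-monoˡ-≤ (- V₁) le) (ℚP.≤-reflexive (cancel V₁ (d₁ * τ) e))
    where
    cancel : ∀ V x e → V + x + e - V ≡ x + e
    cancel = solve 3 (λ V x e → V :+ x :+ e :- V := x :+ e) refl
  move-right : V₂ + d₂ * τ ≤ T₂ + e + e → d₂ * τ ≤ T₂ + e + e - V₂
  move-right le = ℚP.≤-trans (ℚP.≤-reflexive (sym (cancel V₂ (d₂ * τ)))) (ℚP.+-monoˡ-≤ (- V₂) le)
    where
    cancel : ∀ V x → V + x - V ≡ x
    cancel = solve 2 (λ V x → V :+ x :- V := x) refl

record InfiniteGapFamily {k} (C : NMDA k) : Set where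
  field
    word word'    : ℕ → ℕ → Fin k
    tail          : ℕ → Fin k
    word'-prefix  : ∀ ℓ i → i ℕ.< ℓ → word' ℓ i ≡ word ℓ i
    word-tail     : ∀ ℓ j → word ℓ (j ℕ.+ ℓ) ≡ tail j
    limit         : ℕ → ℚ
    seq seq'      : ℕ → ℕ → ℚ
    limit-value   : ∀ ℓ → limit ℓ ≡[1-1/ 3 ^ ℓ ] fromℕ 6
    seq-stable    : ∀ ℓ i → ℓ ℕ.≤ i → seq ℓ i ≡ limit ℓ
    seq'-gap      : ∀ ℓ i → ℓ ℕ.< i → limit ℓ * fromℕ (2 ^ ℓ) + fromℕ 6 ≤ seq' ℓ i * fromℕ (2 ^ ℓ)
    word-value    : ∀ ℓ → InfValueIs C (word ℓ) (seq ℓ)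
    word'-value   : ∀ ℓ → InfValueIs C (word' ℓ) (seq' ℓ)

module InfiniteGaps {k} {C : NMDA k} (IC : Integral C) (F : InfiniteGapFamily C) {d G : ℕ}
                    (γD : ∀ p σ q → IsIntegral (γ C p σ q * fromℕ (suc d)))
                    (∣γ∣≤G : ∀ p σ q → ℚ.∣ γ C p σ q ∣ ≤ fromℕ G) where
  open InfiniteGapFamily F
  open InfiniteRuns C
  open IntegralPaths C IC

  NearOptimal : ℕ → ℚ → (ℕ → Fin (n C)) → Set
  NearOptimal ℓ e r = IsRun C (word ℓ) r × LimLe (partial C (word ℓ) r) (λ i → seq ℓ i + e)

  scale-at : ∀ {ℓ e r} → NearOptimal ℓ e r → ℕ
  scale-at {ℓ} ((_ , path) , _) = path-scale path ℓ

  -- Continuing r along word' ℓ costs at most 4G/P more than r, yet word' ℓ is worth 6/2^ℓ more.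
  near-optimal-scale-bound : ∀ {ℓ e r} → 0ℚ < e → e * fromℕ (2 ^ ℓ) ≤ 1ℚ → (near : NearOptimal ℓ e r) →
                             scale-at near ℕ.≤ 4 ℕ.* G ℕ.* 2 ^ ℓ
  near-optimal-scale-bound {ℓ} {e} {r} 0<e e2^ℓ≤1 near@(valid@(_ , path) , optimal) =
    bound (proj₁ (word'-value ℓ) (splice r ℓ s) (graft-run valid (path-from-path (r ℓ) u)) e 0<e) (optimal e 0<e)
    where
    u : ℕ → Fin k
    u = shift (word' ℓ) ℓ
    s : ℕ → Fin (n C)
    s = path-from (r ℓ) u
    open Graft {w = word ℓ} {w' = word' ℓ} {u} {r} {s} {ℓ} (word'-prefix ℓ) (λ _ → refl) refl
    P : ℕ
    P = scale-at near
    disc : ℚ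
    disc = invDisc C (word ℓ) r ℓ
    bound : (∃ λ N → ∀ i → N ℕ.≤ i → seq' ℓ i ≤ partial C (word' ℓ) (splice r ℓ s) i + e) →
            (∃ λ N → ∀ i → N ℕ.≤ i → partial C (word ℓ) r i ≤ seq ℓ i + e + e) →
            P ℕ.≤ 4 ℕ.* G ℕ.* 2 ^ ℓ
    bound (N₁ , lower) (N₂ , upper) =
      ℕP.≤-trans (ℕP.m≤n*m P 3) (fromℕ-cancel-≤ {3 ℕ.* P} {4 ℕ.* G ℕ.* 2 ^ ℓ} (begin
        fromℕ (3 ℕ.* P)                    ≡⟨ fromℕ-* 3 P ⟩
        fromℕ 3 * fromℕ P                  ≤⟨ ℚP.*-monoʳ-≤-nonNeg (fromℕ P) {{ℚ.nonNegative (fromℕ-nonNeg P)}} 3≤dΔ2^ℓ ⟩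
        disc * Δ * 2^ℓ * fromℕ P              ≡⟨ regroup disc Δ 2^ℓ (fromℕ P) ⟩
        Δ * (2^ℓ * (disc * fromℕ P))          ≡⟨ cong (λ x → Δ * (2^ℓ * x)) (invDisc*path-scale≡1 path ℓ) ⟩
        Δ * (2^ℓ * 1ℚ)
          ≤⟨ ℚP.*-monoʳ-≤-nonNeg (2^ℓ * 1ℚ) {{ℚ.nonNegative (*-nonNeg (fromℕ-nonNeg (2 ^ ℓ)) (ℚP.<⇒≤ 0<1))}} Δ≤4G ⟩
        (fromℕ 2 * fromℕ G + fromℕ 2 * fromℕ G) * (2^ℓ * 1ℚ)   ≡⟨ collect (fromℕ G) 2^ℓ ⟩
        fromℕ 4 * fromℕ G * 2^ℓ            ≡⟨ trans (fromℕ-* (4 ℕ.* G) (2 ^ ℓ)) (cong (_* 2^ℓ) (fromℕ-* 4 G)) ⟨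
        fromℕ (4 ℕ.* G ℕ.* 2 ^ ℓ)          ∎))
      where
      open ℚP.≤-Reasoning
      j i : ℕ
      j = suc (N₁ ℕ.+ N₂)
      i = j ℕ.+ ℓ
      N₁≤i : N₁ ℕ.≤ i
      N₁≤i = ℕP.≤-trans (ℕP.m≤m+n N₁ N₂) (ℕP.≤-trans (ℕP.n≤1+n _) (ℕP.m≤m+n j ℓ))
      N₂≤i : N₂ ℕ.≤ i
      N₂≤i = ℕP.≤-trans (ℕP.m≤n+m N₂ N₁) (ℕP.≤-trans (ℕP.n≤1+n _) (ℕP.m≤m+n j ℓ))
      V τ τ' Δ 2^ℓ : ℚ
      V = partial C (word ℓ) r ℓ
      τ = partial C (shift (word ℓ) ℓ) (shift r ℓ) j
      τ' = partial C u s j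
      Δ = τ' - τ
      2^ℓ = fromℕ (2 ^ ℓ)
      seq'≤ : seq' ℓ i ≤ V + disc * τ' + e
      seq'≤ = subst (λ x → seq' ℓ i ≤ x + e) (graft-partial j) (lower i N₁≤i)
      V+dτ≤ : V + disc * τ ≤ limit ℓ + e + e
      V+dτ≤ = subst₂ (λ x y → x ≤ y + e + e) (partial-+ (word ℓ) r ℓ j) (seq-stable ℓ i (ℕP.m≤n+m ℓ j)) (upper i N₂≤i)
      3≤dΔ2^ℓ : fromℕ 3 ≤ disc * Δ * 2^ℓ
      3≤dΔ2^ℓ = graft-gap {limit ℓ} {seq' ℓ i} {V} {disc} {τ} {τ'} {e} {2^ℓ} (fromℕ-nonNeg (2 ^ ℓ))
                          (seq'-gap ℓ i (ℕ.s≤s (ℕP.m≤n+m ℓ (N₁ ℕ.+ N₂)))) seq'≤ V+dτ≤ e2^ℓ≤1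
      Δ≤4G : Δ ≤ fromℕ 2 * fromℕ G + fromℕ 2 * fromℕ G
      Δ≤4G = ℚP.≤-trans (p≤∣p∣ Δ) (ℚP.≤-trans (ℚP.∣p-q∣≤∣p∣+∣q∣ τ' τ)
               (ℚP.+-mono-≤ (∣partial∣≤2G {G} ∣γ∣≤G (path-from-path (r ℓ) u) j) (∣partial∣≤2G {G} ∣γ∣≤G (shift-path path ℓ) j)))
      regroup : ∀ d Δ X P → d * Δ * X * P ≡ Δ * (X * (d * P))
      regroup = solve 4 (λ d Δ X P → d :* Δ :* X :* P := Δ :* (X :* (d :* P))) refl
      collect : ∀ G X → (fromℕ 2 * G + fromℕ 2 * G) * (X * 1ℚ) ≡ fromℕ 4 * G * X
      collect = solve 2 (λ G X → (con (fromℕ 2) :* G :+ con (fromℕ 2) :* G) :* (X :* con 1ℚ) := con (fromℕ 4) :* G :* X) refl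

  -- Up to e, the value of r's tail beyond ℓ (rescaled by its first ℓ discount factors), which
  -- depends only on the state r ℓ.
  residual : ∀ {ℓ e r} → NearOptimal ℓ e r → ℚ
  residual {ℓ} {r = r} near = (limit ℓ - partial C (word ℓ) r ℓ) * fromℕ (scale-at near)

  residual-swap : ∀ {ℓ₁ ℓ₂ e r₁ r₂} → 0ℚ < e → (near₁ : NearOptimal ℓ₁ e r₁) (near₂ : NearOptimal ℓ₂ e r₂) → r₂ ℓ₂ ≡ r₁ ℓ₁ →
                  residual near₁ ≤ residual near₂ + e * (fromℕ (scale-at near₁) + fromℕ 2 * fromℕ (scale-at near₂))
  residual-swap {ℓ₁} {ℓ₂} {e} {r₁} {r₂} 0<e near₁@(valid₁@(_ , path₁) , _) near₂@((_ , path₂) , optimal₂) same =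
    bound (proj₁ (word-value ℓ₁) (splice r₁ ℓ₁ s) (graft-run valid₁ (shift-path path₂ ℓ₂)) e 0<e) (optimal₂ e 0<e)
    where
    s : ℕ → Fin (n C)
    s = shift r₂ ℓ₂
    open Graft {w = word ℓ₁} {w' = word ℓ₁} {shift (word ℓ₂) ℓ₂} {r₁} {s} {ℓ₁}
               (λ _ _ → refl) (λ j → trans (word-tail ℓ₁ j) (sym (word-tail ℓ₂ j))) same
    bound : (∃ λ N → ∀ i → N ℕ.≤ i → seq ℓ₁ i ≤ partial C (word ℓ₁) (splice r₁ ℓ₁ s) i + e) →
            (∃ λ N → ∀ i → N ℕ.≤ i → partial C (word ℓ₂) r₂ i ≤ seq ℓ₂ i + e + e) →
            residual near₁ ≤ residual near₂ + e * (fromℕ (scale-at near₁) + fromℕ 2 * fromℕ (scale-at near₂))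
    bound (N₁ , lower) (N₂ , upper) =
      swap-gap {limit ℓ₁} {V₁} {d₁} {fromℕ (scale-at near₁)} {limit ℓ₂} {V₂} {d₂} {fromℕ (scale-at near₂)} {τ} {e}
               (invDisc*path-scale≡1 path₁ ℓ₁) (invDisc*path-scale≡1 path₂ ℓ₂)
               (fromℕ-nonNeg (scale-at near₁)) (fromℕ-nonNeg (scale-at near₂)) T₁≤ V₂+d₂τ≤
      where
      j : ℕ
      j = N₁ ℕ.+ N₂
      V₁ V₂ d₁ d₂ τ : ℚ
      V₁ = partial C (word ℓ₁) r₁ ℓ₁
      V₂ = partial C (word ℓ₂) r₂ ℓ₂
      d₁ = invDisc C (word ℓ₁) r₁ ℓ₁
      d₂ = invDisc C (word ℓ₂) r₂ ℓ₂
      τ = partial C (shift (word ℓ₂) ℓ₂) s j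
      T₁≤ : limit ℓ₁ ≤ V₁ + d₁ * τ + e
      T₁≤ = subst₂ (λ x y → x ≤ y + e) (seq-stable ℓ₁ (j ℕ.+ ℓ₁) (ℕP.m≤n+m ℓ₁ j)) (graft-partial j)
                   (lower (j ℕ.+ ℓ₁) (ℕP.≤-trans (ℕP.m≤m+n N₁ N₂) (ℕP.m≤m+n j ℓ₁)))
      V₂+d₂τ≤ : V₂ + d₂ * τ ≤ limit ℓ₂ + e + e
      V₂+d₂τ≤ = subst₂ (λ x y → x ≤ y + e + e) (partial-+ (word ℓ₂) r₂ ℓ₂ j) (seq-stable ℓ₂ (j ℕ.+ ℓ₂) (ℕP.m≤n+m ℓ₂ j))
                       (upper (j ℕ.+ ℓ₂) (ℕP.≤-trans (ℕP.m≤n+m N₂ N₁) (ℕP.m≤m+n j ℓ₂)))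

  residual-congruence-at : ∀ {ℓ e r} (near : NearOptimal ℓ e r) →
                           3 ^ ℓ ∣ℚ residual near * fromℕ (suc d) * fromℕ (3 ^ ℓ) + fromℕ (6 ℕ.* suc d ℕ.* scale-at near)
  residual-congruence-at {ℓ} {r = r} near@((_ , path) , _) =
    residual-congruence {V = partial C (word ℓ) r ℓ} {c = 6} {P = path-scale path ℓ} {s = suc d}
                        (limit-value ℓ) (scaled-partial-integral (suc d) γD path ℓ)

  -- The rescaled residuals Y₁, Y₂ are integers less than 1 apart, hence equal; their residues
  -- modulo 3^(k + ℓ₁) then give 6 (d + 1) P₂ = 6 (d + 1) 3^k P₁.
  same-state-scale : ∀ {ℓ₁ k e r₁ r₂} → 0ℚ < e → (near₁ : NearOptimal ℓ₁ e r₁) (near₂ : NearOptimal (k ℕ.+ ℓ₁) e r₂) →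
    r₂ (k ℕ.+ ℓ₁) ≡ r₁ ℓ₁ →
    let P₁ = scale-at near₁ ; P₂ = scale-at near₂ ; S = fromℕ (suc d) * fromℕ (3 ^ (k ℕ.+ ℓ₁)) in
    e * (fromℕ P₁ + fromℕ 2 * fromℕ P₂) * S < 1ℚ → e * (fromℕ P₂ + fromℕ 2 * fromℕ P₁) * S < 1ℚ →
    6 ℕ.* suc d ℕ.* (P₁ ℕ.* 3 ^ k) ℕ.< 3 ^ (k ℕ.+ ℓ₁) → 6 ℕ.* suc d ℕ.* P₂ ℕ.< 3 ^ (k ℕ.+ ℓ₁) →
    P₂ ≡ P₁ ℕ.* 3 ^ k
  same-state-scale {ℓ₁} {k} {e} {r₁} {r₂} 0<e near₁ near₂ same small₁₂ small₂₁ bound₁ bound₂ =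
    ℕP.*-cancelˡ-≡ P₂ (P₁ ℕ.* 3 ^ k) (6 ℕ.* suc d)
      (∣ℚ-fromℕ-minus⇒≡ bound₂ bound₁ (subst (3 ^ L ∣ℚ_) difference (∣ℚ-minus {3 ^ L} {Y₂ + fromℕ a₂} {Y₁ + fromℕ a₁} div₂ div₁)))
    where
    L P₁ P₂ : ℕ
    L = k ℕ.+ ℓ₁
    P₁ = scale-at near₁
    P₂ = scale-at near₂
    S : ℚ
    S = fromℕ (suc d) * fromℕ (3 ^ L)
    0≤S : 0ℚ ≤ S
    0≤S = *-nonNeg (fromℕ-nonNeg (suc d)) (fromℕ-nonNeg (3 ^ L))
    a₁ a₂ : ℕ
    a₁ = 6 ℕ.* suc d ℕ.* (P₁ ℕ.* 3 ^ k)
    a₂ = 6 ℕ.* suc d ℕ.* P₂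
    Y₁ Y₂ : ℚ
    Y₁ = residual near₁ * fromℕ (suc d) * fromℕ (3 ^ L)
    Y₂ = residual near₂ * fromℕ (suc d) * fromℕ (3 ^ L)
    div₁ : 3 ^ L ∣ℚ Y₁ + fromℕ a₁
    div₁ = subst₂ (λ N a → N ∣ℚ residual near₁ * fromℕ (suc d) * fromℕ N + fromℕ a)
                   (sym (ℕP.^-distribˡ-+-* 3 k ℓ₁)) (ℕP.*-assoc (6 ℕ.* suc d) P₁ (3 ^ k))
                   (∣ℚ-lift {3 ^ ℓ₁} {residual near₁ * fromℕ (suc d)} {6 ℕ.* suc d ℕ.* P₁}
                            (residual-congruence-at near₁) (3 ^ k))
    div₂ : 3 ^ L ∣ℚ Y₂ + fromℕ a₂
    div₂ = residual-congruence-at near₂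
    Y≡ : ∀ x → x * fromℕ (suc d) * fromℕ (3 ^ L) ≡ x * S
    Y≡ x = ℚP.*-assoc x (fromℕ (suc d)) (fromℕ (3 ^ L))
    scaled-swap : ∀ {ℓ ℓ' r r'} (near : NearOptimal ℓ e r) (near' : NearOptimal ℓ' e r') → r' ℓ' ≡ r ℓ →
                  residual near * fromℕ (suc d) * fromℕ (3 ^ L)
                    ≤ residual near' * fromℕ (suc d) * fromℕ (3 ^ L)
                      + e * (fromℕ (scale-at near) + fromℕ 2 * fromℕ (scale-at near')) * S
    scaled-swap near near' same' = subst₂ (λ x y → x ≤ y + e * (fromℕ (scale-at near) + fromℕ 2 * fromℕ (scale-at near')) * S)
      (sym (Y≡ (residual near))) (sym (Y≡ (residual near')))
      (*-mono-≤-+ {residual near} {residual near'} {e * (fromℕ (scale-at near) + fromℕ 2 * fromℕ (scale-at near'))} S 0≤S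
                  (residual-swap 0<e near near' same'))
    Y₁≤Y₂ : Y₁ ≤ Y₂
    Y₁≤Y₂ = integral-≤-+< (∣ℚ-+fromℕ⇒integral {3 ^ L} {Y₁} {a₁} div₁) (∣ℚ-+fromℕ⇒integral {3 ^ L} {Y₂} {a₂} div₂)
              (scaled-swap near₁ near₂ same) small₁₂
    Y₂≤Y₁ : Y₂ ≤ Y₁
    Y₂≤Y₁ = integral-≤-+< (∣ℚ-+fromℕ⇒integral {3 ^ L} {Y₂} {a₂} div₂) (∣ℚ-+fromℕ⇒integral {3 ^ L} {Y₁} {a₁} div₁)
              (scaled-swap near₂ near₁ (sym same)) small₂₁
    difference : Y₂ + fromℕ a₂ - (Y₁ + fromℕ a₁) ≡ fromℕ a₂ - fromℕ a₁
    difference = trans (cong (λ y → Y₂ + fromℕ a₂ - (y + fromℕ a₁)) (ℚP.≤-antisym Y₁≤Y₂ Y₂≤Y₁))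
                       (cancel Y₂ (fromℕ a₂) (fromℕ a₁))
      where
      cancel : ∀ y a b → y + a - (y + b) ≡ a - b
      cancel = solve 3 (λ y a b → y :+ a :- (y :+ b) := a :- b) refl

  B : ℕ
  B = 4 ℕ.* suc G

  K : ℕ
  K = 6 ℕ.* suc d ℕ.* B

  M : ℕ
  M = proj₁ (K*2^n<3^n-eventually K)

  K*2^ℓ<3^ℓ : ∀ {ℓ} → M ℕ.≤ ℓ → K ℕ.* 2 ^ ℓ ℕ.< 3 ^ ℓ
  K*2^ℓ<3^ℓ = proj₂ (K*2^n<3^n-eventually K)

  ℓmax : ℕ
  ℓmax = suc (n C) ℕ.* M

  E : ℕ
  E = 3 ℕ.* (B ℕ.* 2 ^ ℓmax) ℕ.* (suc d ℕ.* 3 ^ ℓmax)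

  -- Abstract: unfolding e would make the type checker normalise 1/(1 + E).
  abstract
    private
      0<1+E : 0ℚ < fromℕ (suc E)
      0<1+E = fromℕ-pos {suc E} (ℕ.s≤s ℕ.z≤n)
      instance
        1+E≢0 : ℚ.NonZero (fromℕ (suc E))
        1+E≢0 = ℚP.pos⇒nonZero (fromℕ (suc E)) {{ℚ.positive 0<1+E}}

    e : ℚ
    e = ℚ.1/ fromℕ (suc E)

    0<e : 0ℚ < e
    0<e = ℚP.positive⁻¹ e {{ℚP.1/pos⇒pos (fromℕ (suc E)) {{ℚ.positive 0<1+E}}}}

    e*N<1 : ∀ {N} → N ℕ.≤ E → e * fromℕ N < 1ℚ
    e*N<1 {N} N≤E = ℚP.≤-<-trans (ℚP.*-monoˡ-≤-nonNeg e {{ℚ.nonNegative (ℚP.<⇒≤ 0<e)}} (fromℕ-mono-≤ {N} {E} N≤E))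
                     (ℚP.<-≤-trans (ℚP.*-monoʳ-<-pos e {{ℚ.positive 0<e}} (fromℕ-mono-< {E} {suc E} ℕP.≤-refl))
                                   (ℚP.≤-reflexive (ℚP.*-inverseˡ (fromℕ (suc E)))))

  2^ℓmax≤E : 2 ^ ℓmax ℕ.≤ E
  2^ℓmax≤E = ℕP.≤-trans (ℕP.m≤n*m (2 ^ ℓmax) (3 ℕ.* B)) (ℕP.≤-trans (ℕP.≤-reflexive (ℕP.*-assoc 3 B (2 ^ ℓmax)))
               (ℕP.m≤m*n (3 ℕ.* (B ℕ.* 2 ^ ℓmax)) (suc d ℕ.* 3 ^ ℓmax)
                         {{ℕ.>-nonZero (ℕP.*-mono-≤ {1} {suc d} (ℕ.s≤s ℕ.z≤n) (ℕP.m^n>0 3 ℓmax))}}))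

  bounded-scale : ∀ {ℓ r} → ℓ ℕ.≤ ℓmax → (near : NearOptimal ℓ e r) → scale-at near ℕ.≤ B ℕ.* 2 ^ ℓ
  bounded-scale {ℓ} ℓ≤ℓmax near = ℕP.≤-trans (near-optimal-scale-bound 0<e e2^ℓ≤1 near)
                                             (ℕP.*-monoˡ-≤ (2 ^ ℓ) (ℕP.*-monoʳ-≤ 4 (ℕP.n≤1+n G)))
    where
    e2^ℓ≤1 : e * fromℕ (2 ^ ℓ) ≤ 1ℚ
    e2^ℓ≤1 = ℚP.<⇒≤ (e*N<1 (ℕP.≤-trans (ℕP.^-monoʳ-≤ 2 ℓ≤ℓmax) 2^ℓmax≤E))

  small-error : ∀ {a b L} → a ℕ.≤ B ℕ.* 2 ^ ℓmax → b ℕ.≤ B ℕ.* 2 ^ ℓmax → L ℕ.≤ ℓmax →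
                e * (fromℕ a + fromℕ 2 * fromℕ b) * (fromℕ (suc d) * fromℕ (3 ^ L)) < 1ℚ
  small-error {a} {b} {L} a≤ b≤ L≤ℓmax = subst (_< 1ℚ) eq (e*N<1 N≤E)
    where
    N : ℕ
    N = (a ℕ.+ 2 ℕ.* b) ℕ.* (suc d ℕ.* 3 ^ L)
    N≤E : N ℕ.≤ E
    N≤E = ℕP.*-mono-≤ (ℕP.≤-trans (ℕP.+-mono-≤ a≤ (ℕP.*-monoʳ-≤ 2 b≤)) (ℕP.≤-reflexive (triple (B ℕ.* 2 ^ ℓmax))))
                      (ℕP.*-monoʳ-≤ (suc d) (ℕP.^-monoʳ-≤ 3 L≤ℓmax))
      where
      triple : ∀ x → x ℕ.+ 2 ℕ.* x ≡ 3 ℕ.* x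
      triple = ℕ-solve-∀
    eq : e * fromℕ N ≡ e * (fromℕ a + fromℕ 2 * fromℕ b) * (fromℕ (suc d) * fromℕ (3 ^ L))
    eq = begin
      e * fromℕ N                                                ≡⟨ cong (e *_) (fromℕ-* (a ℕ.+ 2 ℕ.* b) (suc d ℕ.* 3 ^ L)) ⟩
      e * (fromℕ (a ℕ.+ 2 ℕ.* b) * fromℕ (suc d ℕ.* 3 ^ L))       ≡⟨ cong₂ (λ x y → e * (x * y)) a+2b≡ (fromℕ-* (suc d) (3 ^ L)) ⟩
      e * ((fromℕ a + fromℕ 2 * fromℕ b) * (fromℕ (suc d) * fromℕ (3 ^ L)))  ≡⟨ ℚP.*-assoc e _ _ ⟨
      e * (fromℕ a + fromℕ 2 * fromℕ b) * (fromℕ (suc d) * fromℕ (3 ^ L))    ∎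
      where
      open ≡-Reasoning
      a+2b≡ : fromℕ (a ℕ.+ 2 ℕ.* b) ≡ fromℕ a + fromℕ 2 * fromℕ b
      a+2b≡ = trans (fromℕ-+ a (2 ℕ.* b)) (cong (λ y → fromℕ a + y) (fromℕ-* 2 b))

  6[1+d]P<3^ℓ : ∀ {P ℓ} → M ℕ.≤ ℓ → P ℕ.≤ B ℕ.* 2 ^ ℓ → 6 ℕ.* suc d ℕ.* P ℕ.< 3 ^ ℓ
  6[1+d]P<3^ℓ {P} {ℓ} M≤ℓ P≤ = begin-strict
    6 ℕ.* suc d ℕ.* P              ≤⟨ ℕP.*-monoʳ-≤ (6 ℕ.* suc d) P≤ ⟩
    6 ℕ.* suc d ℕ.* (B ℕ.* 2 ^ ℓ)  ≡⟨ ℕP.*-assoc (6 ℕ.* suc d) B (2 ^ ℓ) ⟨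
    K ℕ.* 2 ^ ℓ                    <⟨ K*2^ℓ<3^ℓ {ℓ} M≤ℓ ⟩
    3 ^ ℓ                          ∎
    where open ℕP.≤-Reasoning

  scale-jump-bound : ∀ {ℓ₁ k r₁ r₂} (near₁ : NearOptimal ℓ₁ e r₁) (near₂ : NearOptimal (k ℕ.+ ℓ₁) e r₂) →
                     k ℕ.+ ℓ₁ ℕ.≤ ℓmax → scale-at near₂ ≡ scale-at near₁ ℕ.* 3 ^ k → 3 ^ k ℕ.≤ B ℕ.* 2 ^ k
  scale-jump-bound {ℓ₁} {k} near₁@((_ , path₁) , _) near₂ L≤ℓmax P₂≡ =
    ℕP.*-cancelʳ-≤ (3 ^ k) (B ℕ.* 2 ^ k) (2 ^ ℓ₁) {{ℕ.>-nonZero (ℕP.m^n>0 2 ℓ₁)}} (begin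
      3 ^ k ℕ.* 2 ^ ℓ₁               ≡⟨ ℕP.*-comm (3 ^ k) (2 ^ ℓ₁) ⟩
      2 ^ ℓ₁ ℕ.* 3 ^ k               ≤⟨ ℕP.*-monoˡ-≤ (3 ^ k) (2^i≤path-scale path₁ ℓ₁) ⟩
      scale-at near₁ ℕ.* 3 ^ k       ≡⟨ P₂≡ ⟨
      scale-at near₂                 ≤⟨ bounded-scale L≤ℓmax near₂ ⟩
      B ℕ.* 2 ^ (k ℕ.+ ℓ₁)           ≡⟨ cong (B ℕ.*_) (ℕP.^-distribˡ-+-* 2 k ℓ₁) ⟩
      B ℕ.* (2 ^ k ℕ.* 2 ^ ℓ₁)       ≡⟨ ℕP.*-assoc B (2 ^ k) (2 ^ ℓ₁) ⟨
      B ℕ.* 2 ^ k ℕ.* 2 ^ ℓ₁         ∎)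
    where open ℕP.≤-Reasoning

  no-repeated-state : ∀ {ℓ₁ ℓ₂ k r₁ r₂} → ℓ₂ ≡ k ℕ.+ ℓ₁ → M ℕ.≤ ℓ₁ → M ℕ.≤ k → ℓ₂ ℕ.≤ ℓmax →
                      NearOptimal ℓ₁ e r₁ → NearOptimal ℓ₂ e r₂ → r₂ ℓ₂ ≡ r₁ ℓ₁ → ⊥
  no-repeated-state {ℓ₁} {k = k} refl M≤ℓ₁ M≤k L≤ℓmax near₁ near₂ same =
    ℕP.<⇒≱ (K*2^ℓ<3^ℓ {k} M≤k)
           (ℕP.≤-trans (scale-jump-bound near₁ near₂ L≤ℓmax P₂≡) (ℕP.*-monoˡ-≤ (2 ^ k) (ℕP.m≤n*m B (6 ℕ.* suc d))))
    where
    L : ℕ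
    L = k ℕ.+ ℓ₁
    ℓ₁≤ℓmax : ℓ₁ ℕ.≤ ℓmax
    ℓ₁≤ℓmax = ℕP.≤-trans (ℕP.m≤n+m ℓ₁ k) L≤ℓmax
    P₁≤ : scale-at near₁ ℕ.≤ B ℕ.* 2 ^ ℓ₁
    P₁≤ = bounded-scale ℓ₁≤ℓmax near₁
    P₂≤ : scale-at near₂ ℕ.≤ B ℕ.* 2 ^ L
    P₂≤ = bounded-scale L≤ℓmax near₂
    widen : ∀ {P ℓ} → ℓ ℕ.≤ ℓmax → P ℕ.≤ B ℕ.* 2 ^ ℓ → P ℕ.≤ B ℕ.* 2 ^ ℓmax
    widen ℓ≤ℓmax P≤ = ℕP.≤-trans P≤ (ℕP.*-monoʳ-≤ B (ℕP.^-monoʳ-≤ 2 ℓ≤ℓmax))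
    bound₁ : 6 ℕ.* suc d ℕ.* (scale-at near₁ ℕ.* 3 ^ k) ℕ.< 3 ^ L
    bound₁ = subst₂ ℕ._<_ (ℕP.*-assoc (6 ℕ.* suc d) (scale-at near₁) (3 ^ k))
                          (trans (ℕP.*-comm (3 ^ ℓ₁) (3 ^ k)) (sym (ℕP.^-distribˡ-+-* 3 k ℓ₁)))
                          (ℕP.*-monoˡ-< (3 ^ k) {{ℕ.>-nonZero (ℕP.m^n>0 3 k)}} (6[1+d]P<3^ℓ M≤ℓ₁ P₁≤))
    P₂≡ : scale-at near₂ ≡ scale-at near₁ ℕ.* 3 ^ k
    P₂≡ = same-state-scale 0<e near₁ near₂ same
            (small-error (widen ℓ₁≤ℓmax P₁≤) (widen L≤ℓmax P₂≤) L≤ℓmax)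
            (small-error (widen L≤ℓmax P₂≤) (widen ℓ₁≤ℓmax P₁≤) L≤ℓmax)
            bound₁ (6[1+d]P<3^ℓ (ℕP.≤-trans M≤k (ℕP.m≤m+n k ℓ₁)) P₂≤)

  level : Fin (suc (n C)) → ℕ
  level t = suc (toℕ t) ℕ.* M

  near-optimal-at : ∀ t → ∃ (NearOptimal (level t) e)
  near-optimal-at t = proj₂ (word-value (level t)) e 0<e

  state-at : Fin (suc (n C)) → Fin (n C)
  state-at t = proj₁ (near-optimal-at t) (level t)

  impossible : ⊥
  impossible with Finₚ.pigeonhole (ℕP.n<1+n (n C)) state-at
  ... | i , j , i<j , same-state =
    let o , 1+i+o≡j = ℕP.m≤n⇒∃[o]m+o≡n i<j in
    no-repeated-state (trans (cong (λ t → suc t ℕ.* M) (sym 1+i+o≡j)) (split (toℕ i) o M))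
      (ℕP.m≤m+n M (toℕ i ℕ.* M)) (ℕP.m≤m+n M (o ℕ.* M)) (ℕP.*-monoˡ-≤ M (ℕ.s≤s (Finₚ.toℕ≤pred[n] j)))
      (proj₂ (near-optimal-at i)) (proj₂ (near-optimal-at j)) (sym same-state)
    where
    split : ∀ a o M → suc (suc a ℕ.+ o) ℕ.* M ≡ suc o ℕ.* M ℕ.+ suc a ℕ.* M
    split = ℕ-solve-∀

no-integral-infinite-gaps : ∀ {k} (C : NMDA k) → Integral C → InfiniteGapFamily C → ⊥
no-integral-infinite-gaps C IC F =
  let d , γD   = weight-denominator C
      G , ∣γ∣≤G = weight-bound C
  in InfiniteGaps.impossible IC F {d} {G} γD ∣γ∣≤G

-- The automata 𝒜 and ℬ

single-state : ∀ {k} (R : ℕ) → 1ℚ < fromℕ R → (Fin k → ℚ) → NMDA k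
single-state R 1<R g = record
  { n = 1 ; ι = λ _ → true ; δ = λ _ _ _ → true ; γ = λ _ σ _ → g σ ; ρ = λ _ _ _ → fromℕ R
  ; ρ>1 = λ _ _ _ → 1<R ; complete = λ _ _ → zero , refl }

module SingleState {k} (R : ℕ) (1<R : 1ℚ < fromℕ R) (g : Fin k → ℚ) where

  X : NMDA k
  X = single-state R 1<R g

  deterministic : Deterministic X
  deterministic = (zero , (λ { zero _ → refl }) , refl) , λ { zero _ zero zero _ _ → refl }

  integral : IntegralNDA X
  integral = R , λ _ _ _ _ → refl

  R⁻¹ : ℚ
  R⁻¹ = inv>1 (fromℕ R) 1<R

  R⁻¹*R≡1 : R⁻¹ * fromℕ R ≡ 1ℚ
  R⁻¹*R≡1 = ℚP.*-inverseˡ (fromℕ R) {{ℚP.pos⇒nonZero (fromℕ R) {{ℚ.positive (ℚP.<-trans 0<1 1<R)}}}}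

  value : List (Fin k) → ℚ
  value []      = 0ℚ
  value (σ ∷ w) = g σ + R⁻¹ * value w

  run-value : ∀ {q w v} → RunFrom X q w v → v ≡ value w
  run-value end                          = refl
  run-value (step {p = zero} {σ} {zero} _ r) = cong (λ v → g σ + R⁻¹ * v) (run-value r)

  value-run : ∀ w → RunFrom X zero w (value w)
  value-run []      = end
  value-run (σ ∷ w) = step refl (value-run w)

  value-is : ∀ w → ValueIs X w (value w)
  value-is w = (zero , refl , value-run w) , λ { v (zero , _ , r) → ℚP.≤-reflexive (sym (run-value r)) }

  value-replicate-++ : ∀ x {c} → g x ≡[1-1/ R ] c → ∀ n u →
                       value (replicate n x ++ u) * fromℕ (R ^ n) ≡ c * fromℕ (R ^ n) - c + value u
  value-replicate-++ x {c} _ zero u = trivial (value u) c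
    where
    trivial : ∀ v c → v * 1ℚ ≡ c * 1ℚ - c + v
    trivial = solve 2 (λ v c → v :* con 1ℚ := c :* con 1ℚ :- c :+ v) refl
  value-replicate-++ x {c} gx≡@(scaled gxR≡) (suc n) u = begin
    (g x + R⁻¹ * V) * fromℕ (R ℕ.* R ^ n)               ≡⟨ cong ((g x + R⁻¹ * V) *_) (fromℕ-* R (R ^ n)) ⟩
    (g x + R⁻¹ * V) * (fromℕ R * fromℕ (R ^ n))         ≡⟨ affine-rescale (g x) R⁻¹ V (fromℕ R) (fromℕ (R ^ n)) R⁻¹*R≡1 ⟩
    g x * fromℕ R * fromℕ (R ^ n) + V * fromℕ (R ^ n)
      ≡⟨ cong₂ (λ a b → a * fromℕ (R ^ n) + b) gxR≡ (value-replicate-++ x gx≡ n u) ⟩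
    (c * fromℕ R - c) * fromℕ (R ^ n) + (c * fromℕ (R ^ n) - c + value u)  ≡⟨ telescope c (fromℕ R) (fromℕ (R ^ n)) (value u) ⟩
    c * (fromℕ R * fromℕ (R ^ n)) - c + value u          ≡⟨ cong (λ y → c * y - c + value u) (fromℕ-* R (R ^ n)) ⟨
    c * fromℕ (R ℕ.* R ^ n) - c + value u                ∎
    where
    open ≡-Reasoning
    V : ℚ
    V = value (replicate n x ++ u)
    telescope : ∀ c r p v → (c * r - c) * p + (c * p - c + v) ≡ c * (r * p) - c + v
    telescope = solve 4 (λ c r p v → (c :* r :- c) :* p :+ (c :* p :- c :+ v) := c :* (r :* p) :- c :+ v) refl

  value-replicate : ∀ x {c} → g x ≡[1-1/ R ] c → ∀ n → value (replicate n x) ≡[1-1/ R ^ n ] c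
  value-replicate x {c} gx≡ n = scaled (subst (λ w → value w * fromℕ (R ^ n) ≡ c * fromℕ (R ^ n) - c)
                                                (++-identityʳ (replicate n x))
                                                (trans (value-replicate-++ x gx≡ n []) (ℚP.+-identityʳ _)))

  run : ℕ → Fin 1
  run _ = zero

  run-valid : ∀ w → IsRun X w run
  run-valid w = refl , λ _ → refl

  invDisc*R^i≡1 : ∀ w i → invDisc X w run i * fromℕ (R ^ i) ≡ 1ℚ
  invDisc*R^i≡1 w zero    = refl
  invDisc*R^i≡1 w (suc i) = begin
    invDisc X w run i * R⁻¹ * fromℕ (R ℕ.* R ^ i)          ≡⟨ cong (invDisc X w run i * R⁻¹ *_) (fromℕ-* R (R ^ i)) ⟩
    invDisc X w run i * R⁻¹ * (fromℕ R * fromℕ (R ^ i))    ≡⟨ interchange (invDisc X w run i) R⁻¹ (fromℕ R) (fromℕ (R ^ i)) ⟩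
    (invDisc X w run i * fromℕ (R ^ i)) * (R⁻¹ * fromℕ R)  ≡⟨ cong₂ _*_ (invDisc*R^i≡1 w i) R⁻¹*R≡1 ⟩
    1ℚ                                                     ∎
    where
    open ≡-Reasoning
    interchange : ∀ a b c d → a * b * (c * d) ≡ (a * d) * (b * c)
    interchange = solve 4 (λ a b c d → a :* b :* (c :* d) := (a :* d) :* (b :* c)) refl

  partial-next : ∀ w i → partial X w run (suc i) * fromℕ (R ^ i) ≡ partial X w run i * fromℕ (R ^ i) + g (w i)
  partial-next w i = begin
    (p + g (w i) * d) * fromℕ (R ^ i)              ≡⟨ expand p (g (w i)) d (fromℕ (R ^ i)) ⟩
    p * fromℕ (R ^ i) + g (w i) * (d * fromℕ (R ^ i))  ≡⟨ cong (λ x → p * fromℕ (R ^ i) + g (w i) * x) (invDisc*R^i≡1 w i) ⟩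
    p * fromℕ (R ^ i) + g (w i) * 1ℚ               ≡⟨ cong (λ x → p * fromℕ (R ^ i) + x) (ℚP.*-identityʳ (g (w i))) ⟩
    p * fromℕ (R ^ i) + g (w i)                    ∎
    where
    open ≡-Reasoning
    p d : ℚ
    p = partial X w run i
    d = invDisc X w run i
    expand : ∀ p g d X → (p + g * d) * X ≡ p * X + g * (d * X)
    expand = solve 4 (λ p g d X → (p :+ g :* d) :* X := p :* X :+ g :* (d :* X)) refl

  partial-replicate : ∀ x {c} → g x ≡[1-1/ R ] c → ∀ w ℓ → (∀ i → i ℕ.< ℓ → w i ≡ x) → partial X w run ℓ ≡[1-1/ R ^ ℓ ] c
  partial-replicate x {c} _ w zero _ = scaled (trivial c)
    where
    trivial : ∀ c → 0ℚ * 1ℚ ≡ c * 1ℚ - c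
    trivial = solve 1 (λ c → con 0ℚ :* con 1ℚ := c :* con 1ℚ :- c) refl
  partial-replicate x {c} gx≡@(scaled gxR≡) w (suc ℓ) w≡x = scaled (begin
    partial X w run (suc ℓ) * fromℕ (R ℕ.* R ^ ℓ)                ≡⟨ cong (partial X w run (suc ℓ) *_) (fromℕ-* R (R ^ ℓ)) ⟩
    partial X w run (suc ℓ) * (fromℕ R * fromℕ (R ^ ℓ))          ≡⟨ reorder (partial X w run (suc ℓ)) (fromℕ R) (fromℕ (R ^ ℓ)) ⟩
    partial X w run (suc ℓ) * fromℕ (R ^ ℓ) * fromℕ R            ≡⟨ cong (_* fromℕ R) (partial-next w ℓ) ⟩
    (partial X w run ℓ * fromℕ (R ^ ℓ) + g (w ℓ)) * fromℕ R      ≡⟨ cong₂ (λ a y → (a + g y) * fromℕ R) IH (w≡x ℓ ℕP.≤-refl) ⟩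
    (c * fromℕ (R ^ ℓ) - c + g x) * fromℕ R                      ≡⟨ expand c (fromℕ (R ^ ℓ)) (g x) (fromℕ R) ⟩
    c * fromℕ (R ^ ℓ) * fromℕ R - c * fromℕ R + g x * fromℕ R    ≡⟨ cong (λ y → c * fromℕ (R ^ ℓ) * fromℕ R - c * fromℕ R + y) gxR≡ ⟩
    c * fromℕ (R ^ ℓ) * fromℕ R - c * fromℕ R + (c * fromℕ R - c)  ≡⟨ telescope c (fromℕ (R ^ ℓ)) (fromℕ R) ⟩
    c * (fromℕ R * fromℕ (R ^ ℓ)) - c                             ≡⟨ cong (λ y → c * y - c) (fromℕ-* R (R ^ ℓ)) ⟨
    c * fromℕ (R ℕ.* R ^ ℓ) - c                                  ∎)
    where
    open ≡-Reasoning
    IH : partial X w run ℓ * fromℕ (R ^ ℓ) ≡ c * fromℕ (R ^ ℓ) - c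
    IH = equation (partial-replicate x gx≡ w ℓ (λ i i<ℓ → w≡x i (ℕP.m<n⇒m<1+n i<ℓ)))
    reorder : ∀ p r q → p * (r * q) ≡ p * q * r
    reorder = solve 3 (λ p r q → p :* (r :* q) := p :* q :* r) refl
    expand : ∀ c q gx r → (c * q - c + gx) * r ≡ c * q * r - c * r + gx * r
    expand = solve 4 (λ c q gx r → (c :* q :- c :+ gx) :* r := c :* q :* r :- c :* r :+ gx :* r) refl
    telescope : ∀ c q r → c * q * r - c * r + (c * r - c) ≡ c * (r * q) - c
    telescope = solve 3 (λ c q r → c :* q :* r :- c :* r :+ (c :* r :- c) := c :* (r :* q) :- c) refl

  partial-silent : ∀ w ℓ → (∀ j → g (w (j ℕ.+ ℓ)) ≡ 0ℚ) → ∀ {i} → ℓ ℕ.≤ i → partial X w run i ≡ partial X w run ℓ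
  partial-silent w ℓ silent {i} ℓ≤i = subst (λ t → partial X w run t ≡ partial X w run ℓ) (ℕP.m∸n+n≡m ℓ≤i) (constant (i ℕ.∸ ℓ))
    where
    constant : ∀ j → partial X w run (j ℕ.+ ℓ) ≡ partial X w run ℓ
    constant zero    = refl
    constant (suc j) = begin
      partial X w run (j ℕ.+ ℓ) + g (w (j ℕ.+ ℓ)) * invDisc X w run (j ℕ.+ ℓ)
        ≡⟨ cong (λ y → partial X w run (j ℕ.+ ℓ) + y * invDisc X w run (j ℕ.+ ℓ)) (silent j) ⟩
      partial X w run (j ℕ.+ ℓ) + 0ℚ * invDisc X w run (j ℕ.+ ℓ)
        ≡⟨ vanish (partial X w run (j ℕ.+ ℓ)) (invDisc X w run (j ℕ.+ ℓ)) ⟩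
      partial X w run (j ℕ.+ ℓ)                                               ≡⟨ constant j ⟩
      partial X w run ℓ                                                       ∎
      where
      open ≡-Reasoning
      vanish : ∀ p d → p + 0ℚ * d ≡ p
      vanish = solve 2 (λ p d → p :+ con 0ℚ :* d := p) refl

pattern σa = zero
pattern σc = suc zero
pattern σb = suc (suc zero)
pattern σh = suc (suc (suc zero))

weight𝒜 weightℬ : Fin 4 → ℚ
weight𝒜 σa = fromℕ 3
weight𝒜 σc = 0ℚ
weight𝒜 σb = fromℕ 12
weight𝒜 σh = 0ℚ
weightℬ σa = fromℕ 4
weightℬ σc = fromℕ 4
weightℬ σb = 0ℚ
weightℬ σh = 0ℚ

1<2 : 1ℚ < fromℕ 2
1<2 = fromℕ-mono-< {1} {2} ℕP.≤-refl

1<3 : 1ℚ < fromℕ 3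
1<3 = fromℕ-mono-< {1} {3} (ℕP.n≤1+n 2)

𝒜 ℬ : NMDA 4
𝒜 = single-state 2 1<2 weight𝒜
ℬ = single-state 3 1<3 weightℬ

module 𝒜 = SingleState 2 1<2 weight𝒜
module ℬ = SingleState 3 1<3 weightℬ

𝒜-a : weight𝒜 σa ≡[1-1/ 2 ] fromℕ 6
𝒜-a = scaled refl

𝒜-c : weight𝒜 σc ≡[1-1/ 2 ] 0ℚ
𝒜-c = scaled refl

ℬ-a : weightℬ σa ≡[1-1/ 3 ] fromℕ 6
ℬ-a = scaled refl

ℬ-c : weightℬ σc ≡[1-1/ 3 ] fromℕ 6
ℬ-c = scaled refl

max-gap : ∀ n {a b a' b'} → a ≡[1-1/ 2 ^ n ] fromℕ 6 → b ≡[1-1/ 3 ^ n ] fromℕ 6 →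
          a' * fromℕ (2 ^ n) ≡ fromℕ 6 * fromℕ (2 ^ n) - fromℕ 6 + fromℕ 12 →
          a ⊔ b ≡[1-1/ 3 ^ n ] fromℕ 6 × (a ⊔ b) * fromℕ (2 ^ n) + fromℕ 6 ≤ (a' ⊔ b') * fromℕ (2 ^ n)
max-gap n {a} {b} {a'} {b'} a≡ b≡ a'≡ = subst (_≡[1-1/ 3 ^ n ] fromℕ 6) (sym a⊔b≡b) b≡ , (begin
  (a ⊔ b) * 2ⁿ + fromℕ 6           ≡⟨ cong (λ x → x * 2ⁿ + fromℕ 6) a⊔b≡b ⟩
  b * 2ⁿ + fromℕ 6
    ≤⟨ ℚP.+-monoˡ-≤ (fromℕ 6) (ℚP.*-monoʳ-≤-nonNeg 2ⁿ {{ℚ.nonNegative (fromℕ-nonNeg (2 ^ n))}} b≤6) ⟩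
  fromℕ 6 * 2ⁿ + fromℕ 6           ≡⟨ shift-constant 2ⁿ ⟩
  fromℕ 6 * 2ⁿ - fromℕ 6 + fromℕ 12  ≡⟨ a'≡ ⟨
  a' * 2ⁿ                          ≤⟨ ℚP.*-monoʳ-≤-nonNeg 2ⁿ {{ℚ.nonNegative (fromℕ-nonNeg (2 ^ n))}} (ℚP.p≤p⊔q a' b') ⟩
  (a' ⊔ b') * 2ⁿ                   ∎)
  where
  open ℚP.≤-Reasoning
  2ⁿ : ℚ
  2ⁿ = fromℕ (2 ^ n)
  0≤6 : 0ℚ ≤ fromℕ 6
  0≤6 = fromℕ-nonNeg 6
  a⊔b≡b : a ⊔ b ≡ b
  a⊔b≡b = ℚP.p≤q⇒p⊔q≡q (≡[1-1/]-mono (1≤2^n n) (2^n≤3^n n) 0≤6 a≡ b≡)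
  b≤6 : b ≤ fromℕ 6
  b≤6 = ≡[1-1/]⇒≤ (ℕP.≤-trans (1≤2^n n) (2^n≤3^n n)) 0≤6 b≡
  shift-constant : ∀ x → fromℕ 6 * x + fromℕ 6 ≡ fromℕ 6 * x - fromℕ 6 + fromℕ 12
  shift-constant = solve 1 (λ x → con (fromℕ 6) :* x :+ con (fromℕ 6)
                                := con (fromℕ 6) :* x :- con (fromℕ 6) :+ con (fromℕ 12)) refl

sum-gap : ∀ n {a b a' b'} → a ≡[1-1/ 2 ^ n ] 0ℚ → b ≡[1-1/ 3 ^ n ] fromℕ 6 →
          a' * fromℕ (2 ^ n) ≡ 0ℚ * fromℕ (2 ^ n) - 0ℚ + fromℕ 12 →
          b' * fromℕ (3 ^ n) ≡ fromℕ 6 * fromℕ (3 ^ n) - fromℕ 6 + 0ℚ →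
          a + b ≡[1-1/ 3 ^ n ] fromℕ 6 × (a + b) * fromℕ (2 ^ n) + fromℕ 6 ≤ (a' + b') * fromℕ (2 ^ n)
sum-gap n {a} {b} {a'} {b'} a≡ b≡ a'≡ b'≡ = subst (_≡[1-1/ 3 ^ n ] fromℕ 6) (sym a+b≡b) b≡ , (begin
  (a + b) * 2ⁿ + fromℕ 6       ≡⟨ cong (λ x → x * 2ⁿ + fromℕ 6) a+b≡b ⟩
  b * 2ⁿ + fromℕ 6             ≤⟨ ℚP.+-monoʳ-≤ (b * 2ⁿ) (fromℕ-mono-≤ {6} {12} (ℕP.m≤m+n 6 6)) ⟩
  b * 2ⁿ + fromℕ 12            ≡⟨ regroup b 2ⁿ ⟩
  (0ℚ * 2ⁿ - 0ℚ + fromℕ 12) + b * 2ⁿ  ≡⟨ cong₂ _+_ a'≡ (cong (_* 2ⁿ) b'≡b) ⟨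
  a' * 2ⁿ + b' * 2ⁿ            ≡⟨ ℚP.*-distribʳ-+ 2ⁿ a' b' ⟨
  (a' + b') * 2ⁿ               ∎)
  where
  open ℚP.≤-Reasoning
  2ⁿ : ℚ
  2ⁿ = fromℕ (2 ^ n)
  a≡0 : a ≡ 0ℚ
  a≡0 = *-cancelʳ-≡-fromℕ {X = 2 ^ n} (1≤2^n n) (trans (equation a≡) (vanish 2ⁿ))
    where
    vanish : ∀ x → 0ℚ * x - 0ℚ ≡ 0ℚ * x
    vanish = solve 1 (λ x → con 0ℚ :* x :- con 0ℚ := con 0ℚ :* x) refl
  a+b≡b : a + b ≡ b
  a+b≡b = trans (cong (_+ b) a≡0) (ℚP.+-identityˡ b)
  regroup : ∀ b x → b * x + fromℕ 12 ≡ (0ℚ * x - 0ℚ + fromℕ 12) + b * x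
  regroup = solve 2 (λ b x → b :* x :+ con (fromℕ 12) := (con 0ℚ :* x :- con 0ℚ :+ con (fromℕ 12)) :+ b :* x) refl
  b'≡b : b' ≡ b
  b'≡b = *-cancelʳ-≡-fromℕ {X = 3 ^ n} (ℕP.≤-trans (1≤2^n n) (2^n≤3^n n))
                           (trans b'≡ (trans (ℚP.+-identityʳ _) (sym (equation b≡))))

finite-max-gaps : ∀ C → ComputesMaxFin C 𝒜 ℬ → ∀ n → FiniteGap C (suc n)
finite-max-gaps C computes n = w , σb , _ , _ ,
  computes w (σa , _ , refl) _ _ (𝒜.value-is w) (ℬ.value-is w) ,
  computes wb (σa , _ , refl) _ _ (𝒜.value-is wb) (ℬ.value-is wb) ,
  max-gap (suc n) {a' = 𝒜.value wb} {b' = ℬ.value wb}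
    (𝒜.value-replicate σa 𝒜-a (suc n)) (ℬ.value-replicate σa ℬ-a (suc n)) (𝒜.value-replicate-++ σa 𝒜-a (suc n) (σb ∷ []))
  where
  w wb : List (Fin 4)
  w  = replicate (suc n) σa
  wb = w ++ σb ∷ []

finite-sum-gaps : ∀ C → ComputesSumFin C 𝒜 ℬ → ∀ n → FiniteGap C (suc n)
finite-sum-gaps C computes n = w , σb , _ , _ ,
  computes w (σc , _ , refl) _ _ (𝒜.value-is w) (ℬ.value-is w) ,
  computes wb (σc , _ , refl) _ _ (𝒜.value-is wb) (ℬ.value-is wb) ,
  sum-gap (suc n) {a' = 𝒜.value wb} {b' = ℬ.value wb}
    (𝒜.value-replicate σc 𝒜-c (suc n)) (ℬ.value-replicate σc ℬ-c (suc n))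
    (𝒜.value-replicate-++ σc 𝒜-c (suc n) (σb ∷ [])) (ℬ.value-replicate-++ σc ℬ-c (suc n) (σb ∷ []))
  where
  w wb : List (Fin 4)
  w  = replicate (suc n) σc
  wb = w ++ σb ∷ []

silent : ℕ → Fin 4
silent _ = σh

σb-then-silent : ℕ → Fin 4
σb-then-silent zero    = σb
σb-then-silent (suc _) = σh

module PrefixWords (x : Fin 4) where

  word word' : ℕ → ℕ → Fin 4
  word  ℓ = splice (λ _ → x) ℓ silent
  word' ℓ = splice (λ _ → x) ℓ σb-then-silent

  word-prefix : ∀ ℓ i → i ℕ.< ℓ → word ℓ i ≡ x
  word-prefix ℓ i = splice-< (λ _ → x) ℓ silent

  word'-prefix : ∀ ℓ i → i ℕ.< ℓ → word' ℓ i ≡ x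
  word'-prefix ℓ i = splice-< (λ _ → x) ℓ σb-then-silent

  word-tail : ∀ ℓ j → word ℓ (j ℕ.+ ℓ) ≡ σh
  word-tail ℓ = splice-+ (λ _ → x) ℓ silent

  word'-at : ∀ ℓ → word' ℓ ℓ ≡ σb
  word'-at ℓ = splice-+ (λ _ → x) ℓ σb-then-silent 0

  word'-tail : ∀ ℓ j → word' ℓ (j ℕ.+ suc ℓ) ≡ σh
  word'-tail ℓ j = trans (cong (word' ℓ) (ℕP.+-suc j ℓ)) (splice-+ (λ _ → x) ℓ σb-then-silent (suc j))

module PrefixWordValues (R : ℕ) (1<R : 1ℚ < fromℕ R) (g : Fin 4 → ℚ) (g-σh : g σh ≡ 0ℚ)
                        (x : Fin 4) {c : ℚ} (gx≡ : g x ≡[1-1/ R ] c) where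
  open SingleState R 1<R g
  open PrefixWords x

  partial-word : ∀ ℓ → partial X (word ℓ) run ℓ ≡[1-1/ R ^ ℓ ] c
  partial-word ℓ = partial-replicate x gx≡ (word ℓ) ℓ (word-prefix ℓ)

  partial-word-stable : ∀ ℓ {i} → ℓ ℕ.≤ i → partial X (word ℓ) run i ≡ partial X (word ℓ) run ℓ
  partial-word-stable ℓ = partial-silent (word ℓ) ℓ (λ j → trans (cong g (word-tail ℓ j)) g-σh)

  partial-word' : ∀ ℓ {i} → ℓ ℕ.< i → partial X (word' ℓ) run i * fromℕ (R ^ ℓ) ≡ c * fromℕ (R ^ ℓ) - c + g σb
  partial-word' ℓ {i} ℓ<i = begin
    partial X (word' ℓ) run i * fromℕ (R ^ ℓ)
      ≡⟨ cong (_* fromℕ (R ^ ℓ)) (partial-silent (word' ℓ) (suc ℓ) (λ j → trans (cong g (word'-tail ℓ j)) g-σh) ℓ<i) ⟩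
    partial X (word' ℓ) run (suc ℓ) * fromℕ (R ^ ℓ)    ≡⟨ partial-next (word' ℓ) ℓ ⟩
    partial X (word' ℓ) run ℓ * fromℕ (R ^ ℓ) + g (word' ℓ ℓ)
      ≡⟨ cong₂ (λ a y → a + g y) (equation (partial-replicate x gx≡ (word' ℓ) ℓ (word'-prefix ℓ))) (word'-at ℓ) ⟩
    c * fromℕ (R ^ ℓ) - c + g σb                        ∎
    where open ≡-Reasoning

infinite-max-gaps : ∀ C → ComputesMaxInf C 𝒜 ℬ → InfiniteGapFamily C
infinite-max-gaps C computes = record
  { word = word ; word' = word' ; tail = silent
  ; word'-prefix = λ ℓ i i<ℓ → trans (word'-prefix ℓ i i<ℓ) (sym (word-prefix ℓ i i<ℓ))
  ; word-tail = word-tail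
  ; limit = λ ℓ → a ℓ ℓ ⊔ b ℓ ℓ
  ; seq = λ ℓ i → a ℓ i ⊔ b ℓ i
  ; seq' = λ ℓ i → a' ℓ i ⊔ b' ℓ i
  ; limit-value = λ ℓ → proj₁ (gap ℓ (suc ℓ) ℕP.≤-refl)
  ; seq-stable = λ ℓ i ℓ≤i → cong₂ _⊔_ (𝒜ₚ.partial-word-stable ℓ ℓ≤i) (ℬₚ.partial-word-stable ℓ ℓ≤i)
  ; seq'-gap = λ ℓ i ℓ<i → proj₂ (gap ℓ i ℓ<i)
  ; word-value = λ ℓ → computes (word ℓ) 𝒜.run ℬ.run (𝒜.run-valid (word ℓ)) (ℬ.run-valid (word ℓ))
  ; word'-value = λ ℓ → computes (word' ℓ) 𝒜.run ℬ.run (𝒜.run-valid (word' ℓ)) (ℬ.run-valid (word' ℓ))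
  }
  where
  open PrefixWords σa
  module 𝒜ₚ = PrefixWordValues 2 1<2 weight𝒜 refl σa 𝒜-a
  module ℬₚ = PrefixWordValues 3 1<3 weightℬ refl σa ℬ-a
  a b a' b' : ℕ → ℕ → ℚ
  a  ℓ = partial 𝒜 (word ℓ) 𝒜.run
  b  ℓ = partial ℬ (word ℓ) ℬ.run
  a' ℓ = partial 𝒜 (word' ℓ) 𝒜.run
  b' ℓ = partial ℬ (word' ℓ) ℬ.run
  gap : ∀ ℓ i → ℓ ℕ.< i → a ℓ ℓ ⊔ b ℓ ℓ ≡[1-1/ 3 ^ ℓ ] fromℕ 6 ×
                          (a ℓ ℓ ⊔ b ℓ ℓ) * fromℕ (2 ^ ℓ) + fromℕ 6 ≤ (a' ℓ i ⊔ b' ℓ i) * fromℕ (2 ^ ℓ)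
  gap ℓ i ℓ<i = max-gap ℓ {a' = a' ℓ i} {b' = b' ℓ i} (𝒜ₚ.partial-word ℓ) (ℬₚ.partial-word ℓ) (𝒜ₚ.partial-word' ℓ ℓ<i)

infinite-sum-gaps : ∀ C → ComputesSumInf C 𝒜 ℬ → InfiniteGapFamily C
infinite-sum-gaps C computes = record
  { word = word ; word' = word' ; tail = silent
  ; word'-prefix = λ ℓ i i<ℓ → trans (word'-prefix ℓ i i<ℓ) (sym (word-prefix ℓ i i<ℓ))
  ; word-tail = word-tail
  ; limit = λ ℓ → a ℓ ℓ + b ℓ ℓ
  ; seq = λ ℓ i → a ℓ i + b ℓ i
  ; seq' = λ ℓ i → a' ℓ i + b' ℓ i
  ; limit-value = λ ℓ → proj₁ (gap ℓ (suc ℓ) ℕP.≤-refl)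
  ; seq-stable = λ ℓ i ℓ≤i → cong₂ _+_ (𝒜ₚ.partial-word-stable ℓ ℓ≤i) (ℬₚ.partial-word-stable ℓ ℓ≤i)
  ; seq'-gap = λ ℓ i ℓ<i → proj₂ (gap ℓ i ℓ<i)
  ; word-value = λ ℓ → computes (word ℓ) 𝒜.run ℬ.run (𝒜.run-valid (word ℓ)) (ℬ.run-valid (word ℓ))
  ; word'-value = λ ℓ → computes (word' ℓ) 𝒜.run ℬ.run (𝒜.run-valid (word' ℓ)) (ℬ.run-valid (word' ℓ))
  }
  where
  open PrefixWords σc
  module 𝒜ₚ = PrefixWordValues 2 1<2 weight𝒜 refl σc 𝒜-c
  module ℬₚ = PrefixWordValues 3 1<3 weightℬ refl σc ℬ-c
  a b a' b' : ℕ → ℕ → ℚ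
  a  ℓ = partial 𝒜 (word ℓ) 𝒜.run
  b  ℓ = partial ℬ (word ℓ) ℬ.run
  a' ℓ = partial 𝒜 (word' ℓ) 𝒜.run
  b' ℓ = partial ℬ (word' ℓ) ℬ.run
  gap : ∀ ℓ i → ℓ ℕ.< i → a ℓ ℓ + b ℓ ℓ ≡[1-1/ 3 ^ ℓ ] fromℕ 6 ×
                          (a ℓ ℓ + b ℓ ℓ) * fromℕ (2 ^ ℓ) + fromℕ 6 ≤ (a' ℓ i + b' ℓ i) * fromℕ (2 ^ ℓ)
  gap ℓ i ℓ<i = sum-gap ℓ {a' = a' ℓ i} {b' = b' ℓ i} (𝒜ₚ.partial-word ℓ) (ℬₚ.partial-word ℓ)
                        (𝒜ₚ.partial-word' ℓ ℓ<i) (ℬₚ.partial-word' ℓ ℓ<i)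

theorem3p2 : (Σ ℕ λ k → Σ (NMDA (suc k)) λ A → Σ (NMDA (suc k)) λ B →
       Deterministic A × IntegralNDA A × Deterministic B × IntegralNDA B ×
       ¬ (∃ λ C → Integral C × ComputesMaxFin C A B) ×
       ¬ (∃ λ C → Integral C × ComputesSumFin C A B))
    ×
    (Σ ℕ λ k → Σ (NMDA (suc k)) λ A → Σ (NMDA (suc k)) λ B →
       Deterministic A × IntegralNDA A × Deterministic B × IntegralNDA B ×
       ¬ (∃ λ C → Integral C × ComputesMaxInf C A B) ×
       ¬ (∃ λ C → Integral C × ComputesSumInf C A B))
theorem3p2 =
  (3 , 𝒜 , ℬ , 𝒜.deterministic , 𝒜.integral , ℬ.deterministic , ℬ.integral ,
   (λ (C , IC , computes) → no-integral-finite-gaps C IC (finite-max-gaps C computes)) ,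
   (λ (C , IC , computes) → no-integral-finite-gaps C IC (finite-sum-gaps C computes))) ,
  (3 , 𝒜 , ℬ , 𝒜.deterministic , 𝒜.integral , ℬ.deterministic , ℬ.integral ,
   (λ (C , IC , computes) → no-integral-infinite-gaps C IC (infinite-max-gaps C computes)) ,
   (λ (C , IC , computes) → no-integral-infinite-gaps C IC (infinite-sum-gaps C computes)))
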